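{- For any finite set of prime numbers $P$, there exists a punctual copy $\mathcal{B} = (\mathbb{N}, S^{\mathcal{B}})$ of $\mathcal{S} = (\mathbb{N}, S)$ such that the only linear functions $f(x) = ax+b$ (with $a,b\in\mathbb{N}$) that are primitive recursive on $\mathcal{B}$ are those for which $a$ has no prime divisors outside of $P$.
   Context: $S$ is the successor on $\mathbb{N}$. A copy of $\mathcal{S}$ is a structure $\mathcal{B} = (\mathbb{N}, S^{\mathcal{B}})$ isomorphic to $(\mathbb{N}, S)$; it is punctual if $S^{\mathcal{B}}$ is primitive recursive. With $c: (\mathbb{N},S)\to\mathcal{B}$ the isomorphism, a unary function $f$ is primitive recursive on $\mathcal{B}$ if $f^{\mathcal{B}} = c\circ f\circ c^{ -1}$ is primitive recursive. -}

module Defs where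

open import Data.Nat using (ℕ; zero; suc; _+_; _*_)
open import Data.Fin using (Fin)
open import Data.Vec using (Vec; []; _∷_; lookup; map)
open import Data.Product using (Σ; _×_)
open import Relation.Binary.PropositionalEquality using (_≡_)

data PR : ℕ → Set where
  pzero : PR 0
  psucc : PR 1
  pproj : ∀ {n} → Fin n → PR n
  pcomp : ∀ {k n} → PR k → Vec (PR n) k → PR n
  prec  : ∀ {n} → PR n → PR (suc (suc n)) → PR (suc n)

mutual
  eval : ∀ {n} → PR n → Vec ℕ n → ℕ
  eval pzero      _        = 0
  eval psucc      (x ∷ []) = suc x
  eval (pproj i)  xs       = lookup xs i
  eval (pcomp f gs) xs     = eval f (evalAll gs xs)
  eval (prec f g) (zero ∷ xs)  = eval f xs
  eval (prec f g) (suc m ∷ xs) = eval g (eval (prec f g) (m ∷ xs) ∷ m ∷ xs)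

  evalAll : ∀ {k n} → Vec (PR n) k → Vec ℕ n → Vec ℕ k
  evalAll []       xs = []
  evalAll (g ∷ gs) xs = eval g xs ∷ evalAll gs xs

PrimRec₁ : (ℕ → ℕ) → Set
PrimRec₁ g = Σ (PR 1) λ t → ∀ x → eval t (x ∷ []) ≡ g x

-- A copy B = (ℕ, S^B) of (ℕ, S), with the isomorphism c : (ℕ,S) → B
-- given as a bijection (c, c⁻¹) satisfying c (S x) = S^B (c x).
record CopyOfS : Set where
  field
    SB    : ℕ → ℕ
    c     : ℕ → ℕ
    cinv  : ℕ → ℕ
    cinv-c : ∀ x → cinv (c x) ≡ x
    c-cinv : ∀ y → c (cinv y) ≡ y
    c-hom  : ∀ x → c (suc x) ≡ SB (c x)

Punctual : CopyOfS → Set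
Punctual B = PrimRec₁ (CopyOfS.SB B)

PrimRecOn : CopyOfS → (ℕ → ℕ) → Set
PrimRecOn B f = PrimRec₁ (λ y → CopyOfS.c B (f (CopyOfS.cinv B y)))

linear : ℕ → ℕ → ℕ → ℕ
linear a b x = a * x + b

-- Positions n ≥ 1 are cut into chunks Y k ≤ n < Y (k + 1), where Y (k + 1) = Y k · Z k and Z k is a
-- value of level k + 1 of the fast-growing hierarchy, so Y outgrows every primitive recursive
-- function; still, "j < Y k" is primitive recursive in (k, j), because the hierarchy capped at B + 1
-- can be tabulated primitive recursively.  Inside chunk k write n = s · Y k + j with 0 < s < Z k and
-- j < Y k, and code n by the triple (k, s, j) when s is P-smooth (s ∣ (∏ P) ^ s), by (k, s, Y k + j)
-- otherwise.  The copy lists the valid codes in increasing order.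
--
-- Successor and multiplication by a P-smooth a only ever need Y k when the offset of their result
-- is already at least Y k, where computing it is cheap; so they, and hence all x ↦ a x + b with
-- P-smooth a, are primitive recursive on the copy.  If a has a prime factor outside P, the block a of
-- chunk k is rough, so x ↦ a x + b sends Y k, whose code (k, 1, 0) is small, to a code above all the
-- codes (k, 1, j) with j < Y k: a jump from about k² to at least Y k, which no primitive recursive
-- function makes for large k.

module Submission where

open import Defs
open import Data.Nat using (ℕ; _≥_)
open import Data.Nat.Divisibility using (_∣_)
open import Data.Nat.Primality using (Prime)
open import Data.List using (List)
open import Data.List.Relation.Unary.All using (All)
open import Data.List.Membership.Propositional using (_∈_)
open import Data.Product using (Σ; _×_)
open import Function.Bundles using (_⇔_)

open import Data.Nat
open import Data.Nat.Properties
open import Data.Nat.DivMod using (m≡m%n+[m/n]*n; m%n<n)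
open import Data.Nat.Divisibility using (divides; ∣-trans; ∣1⇒≡1; *-pres-∣; m%n≡0⇒n∣m; n∣m⇒m%n≡0)
open import Data.Nat.GeneralisedArithmetic using (fold)
open import Data.Nat.ListAction using (product)
open import Data.Nat.ListAction.Properties using (∈⇒∣product)
open import Data.Nat.Primality using (euclidsLemma; ¬prime[1]; prime⇒nonTrivial)
open import Data.Nat.Primality.Factorisation using (factorisationHasAllPrimeFactors; PrimeFactorisation; factorise)
open import Data.Nat.Tactic.RingSolver using (solve-∀)
import Data.Fin as Fin
open Fin using (Fin; #_; _↑ʳ_)
open import Data.Vec using (Vec; []; _∷_; lookup; tabulate; _++_; foldr′)
open import Data.Vec.Properties using (tabulate∘lookup; tabulate-cong; lookup-++ʳ)
open import Data.List using ([]; _∷_)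
import Data.List.Relation.Unary.All as All
open import Data.List.Relation.Unary.Any using (here; there)
open import Data.Product using (∃; ∃₂; _,_; proj₁; proj₂)
open import Data.Sum using (_⊎_; inj₁; inj₂; [_,_]′)
open import Data.Empty using (⊥-elim)
open import Function using (_∘_)
open import Function.Bundles using (mk⇔)
open import Relation.Nullary using (¬_; Dec; yes; no)
open import Relation.Binary.Core using (_Preserves_⟶_)
open import Relation.Binary.Definitions using (tri<; tri≈; tri>)
open import Relation.Binary.PropositionalEquality

-- Primitive recursive functions as expressions

Op : ℕ → Set
Op zero    = ℕ
Op (suc n) = ℕ → Op n

apply : ∀ {n} → Op n → Vec ℕ n → ℕ
apply f []       = f
apply f (x ∷ xs) = apply (f x) xs

curryOp : ∀ {n} → (Vec ℕ n → ℕ) → Op n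
curryOp {zero}  g   = g []
curryOp {suc n} g x = curryOp (λ xs → g (x ∷ xs))

apply-curryOp : ∀ {n} (g : Vec ℕ n → ℕ) xs → apply (curryOp g) xs ≡ g xs
apply-curryOp g []       = refl
apply-curryOp g (x ∷ xs) = apply-curryOp (λ ys → g (x ∷ ys)) xs

infix 4 _≗ⁿ_

_≗ⁿ_ : ∀ {n} → (Vec ℕ n → ℕ) → Op n → Set
_≗ⁿ_ {zero}  g f = g [] ≡ f
_≗ⁿ_ {suc n} g f = ∀ x → (λ xs → g (x ∷ xs)) ≗ⁿ f x

≗ⁿ⇒≗apply : ∀ {n} {g : Vec ℕ n → ℕ} {f : Op n} → g ≗ⁿ f → ∀ xs → g xs ≡ apply f xs
≗ⁿ⇒≗apply p []       = p
≗ⁿ⇒≗apply p (x ∷ xs) = ≗ⁿ⇒≗apply (p x) xs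

≗apply⇒≗ⁿ : ∀ {n} {g : Vec ℕ n → ℕ} {f : Op n} → (∀ xs → g xs ≡ apply f xs) → g ≗ⁿ f
≗apply⇒≗ⁿ {zero}  p   = p []
≗apply⇒≗ⁿ {suc n} p x = ≗apply⇒≗ⁿ (λ xs → p (x ∷ xs))

-- Curried, so that PrimRec 1 f is definitionally Defs.PrimRec₁ f.
PrimRec : ∀ n → Op n → Set
PrimRec n f = Σ (PR n) λ t → eval t ≗ⁿ f

rec : ℕ → (ℕ → ℕ → ℕ) → ℕ → ℕ
rec a s zero    = a
rec a s (suc m) = s (rec a s m) m

rec-cong : ∀ {s s′ : ℕ → ℕ → ℕ} a → (∀ u i → s u i ≡ s′ u i) → ∀ m → rec a s m ≡ rec a s′ m
rec-cong a e zero             = refl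
rec-cong {s} {s′} a e (suc m) = trans (cong (λ u → s u m) (rec-cong a e m)) (e _ m)

-- A call node carries an already compiled function, so ⟦_⟧ unfolds to the intended function and
-- most proofs of PrimRec below are refl.
data Exp : ℕ → Set where
  var  : ∀ {n} → Fin n → Exp n
  lit  : ∀ {n} → ℕ → Exp n
  call : ∀ {n k} (f : Op k) → PrimRec k f → Vec (Exp n) k → Exp n
  loop : ∀ {n} → Exp n → Exp n → Exp (2 + n) → Exp n

mutual
  ⟦_⟧ : ∀ {n} → Exp n → Vec ℕ n → ℕ
  ⟦ var i ⟧        xs = lookup xs i
  ⟦ lit k ⟧        xs = k
  ⟦ call f _ es ⟧  xs = apply f (⟦ es ⟧* xs)
  ⟦ loop c a s ⟧   xs = rec (⟦ a ⟧ xs) (λ acc i → ⟦ s ⟧ (acc ∷ i ∷ xs)) (⟦ c ⟧ xs)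

  ⟦_⟧* : ∀ {n k} → Vec (Exp n) k → Vec ℕ n → Vec ℕ k
  ⟦ [] ⟧*     xs = []
  ⟦ e ∷ es ⟧* xs = ⟦ e ⟧ xs ∷ ⟦ es ⟧* xs

numeral : ℕ → PR 0
numeral zero    = pzero
numeral (suc k) = pcomp psucc (numeral k ∷ [])

eval-numeral : ∀ k → eval (numeral k) [] ≡ k
eval-numeral zero    = refl
eval-numeral (suc k) = cong suc (eval-numeral k)

projections : ∀ {n} → Vec (PR n) n
projections = tabulate pproj

evalAll-projections : ∀ {n} (xs : Vec ℕ n) → evalAll projections xs ≡ xs
evalAll-projections xs = trans (evalAll-tabulate xs) (tabulate∘lookup xs)
  where
  evalAll-tabulate : ∀ {n k} (xs : Vec ℕ n) {g : Fin k → Fin n} →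
    evalAll (tabulate (pproj ∘ g)) xs ≡ tabulate (lookup xs ∘ g)
  evalAll-tabulate {k = zero}  xs     = refl
  evalAll-tabulate {k = suc k} xs {g} = cong (lookup xs (g Fin.zero) ∷_) (evalAll-tabulate xs)

mutual
  compile : ∀ {n} (e : Exp n) → Σ (PR n) λ t → ∀ xs → eval t xs ≡ ⟦ e ⟧ xs
  compile (var i)             = pproj i , λ xs → refl
  compile (lit k)             = pcomp (numeral k) [] , λ xs → eval-numeral k
  compile (call f (t , p) es) with compileAll es
  ... | ts , q = pcomp t ts , λ xs → trans (cong (eval t) (q xs)) (≗ⁿ⇒≗apply p _)
  compile (loop c a s) with compile c | compile a | compile s
  ... | tc , pc | ta , pa | ts , ps =
    pcomp (prec ta ts) (tc ∷ projections) , λ xs →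
      trans (cong₂ (λ m ys → eval (prec ta ts) (m ∷ ys)) (pc xs) (evalAll-projections xs))
            (eval-prec xs (⟦ c ⟧ xs))
    where
    eval-prec : ∀ xs m → eval (prec ta ts) (m ∷ xs) ≡ rec (⟦ a ⟧ xs) (λ acc i → ⟦ s ⟧ (acc ∷ i ∷ xs)) m
    eval-prec xs zero    = pa xs
    eval-prec xs (suc m) = trans (ps _) (cong (λ u → ⟦ s ⟧ (u ∷ m ∷ xs)) (eval-prec xs m))

  compileAll : ∀ {n k} (es : Vec (Exp n) k) → Σ (Vec (PR n) k) λ ts → ∀ xs → evalAll ts xs ≡ ⟦ es ⟧* xs
  compileAll []       = [] , λ xs → refl
  compileAll (e ∷ es) with compile e | compileAll es
  ... | t , p | ts , q = t ∷ ts , λ xs → cong₂ _∷_ (p xs) (q xs)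

primRec : ∀ {n} {f : Op n} (e : Exp n) → ⟦ e ⟧ ≗ⁿ f → PrimRec n f
primRec e p with compile e
... | t , q = t , ≗apply⇒≗ⁿ (λ xs → trans (q xs) (≗ⁿ⇒≗apply p xs))

PrimRec₁-≗ : ∀ {f g : ℕ → ℕ} → PrimRec 1 f → (∀ x → f x ≡ g x) → PrimRec 1 g
PrimRec₁-≗ (t , p) f≗g = t , λ x → trans (p x) (f≗g x)

∘-primRec : ∀ {f g : ℕ → ℕ} → PrimRec 1 f → PrimRec 1 g → PrimRec 1 (λ x → f (g x))
∘-primRec {f} {g} f-pr g-pr = primRec (call f f-pr (call g g-pr (var (# 0) ∷ []) ∷ [])) λ x → refl

infixl 6 _+ᵉ_ _∸ᵉ_
infixl 7 _*ᵉ_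
infixr 8 _^ᵉ_

suc-primRec : PrimRec 1 suc
suc-primRec = psucc , λ x → refl

sucᵉ : ∀ {n} → Exp n → Exp n
sucᵉ a = call suc suc-primRec (a ∷ [])

+-primRec : PrimRec 2 _+_
+-primRec = primRec (loop (var (# 0)) (var (# 1)) (sucᵉ (var (# 0)))) rec-+
  where
  rec-+ : ∀ x y → rec y (λ acc _ → suc acc) x ≡ x + y
  rec-+ zero    y = refl
  rec-+ (suc x) y = cong suc (rec-+ x y)

_+ᵉ_ : ∀ {n} → Exp n → Exp n → Exp n
a +ᵉ b = call _+_ +-primRec (a ∷ b ∷ [])

*-primRec : PrimRec 2 _*_
*-primRec = primRec (loop (var (# 0)) (lit 0) (var (# 0) +ᵉ var (# 3))) rec-*
  where
  rec-* : ∀ x y → rec 0 (λ acc _ → acc + y) x ≡ x * y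
  rec-* zero    y = refl
  rec-* (suc x) y = trans (cong (_+ y) (rec-* x y)) (+-comm (x * y) y)

_*ᵉ_ : ∀ {n} → Exp n → Exp n → Exp n
a *ᵉ b = call _*_ *-primRec (a ∷ b ∷ [])

pred-primRec : PrimRec 1 pred
pred-primRec = primRec (loop (var (# 0)) (lit 0) (var (# 1))) λ { zero → refl ; (suc x) → refl }

∸-primRec : PrimRec 2 _∸_
∸-primRec = primRec (loop (var (# 1)) (var (# 0)) (call pred pred-primRec (var (# 0) ∷ []))) rec-∸
  where
  rec-∸ : ∀ x y → rec x (λ acc _ → pred acc) y ≡ x ∸ y
  rec-∸ x zero    = refl
  rec-∸ x (suc y) = trans (cong pred (rec-∸ x y)) (pred[m∸n]≡m∸[1+n] x y)

_∸ᵉ_ : ∀ {n} → Exp n → Exp n → Exp n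
a ∸ᵉ b = call _∸_ ∸-primRec (a ∷ b ∷ [])

^-primRec : PrimRec 2 _^_
^-primRec = primRec (loop (var (# 1)) (lit 1) (var (# 0) *ᵉ var (# 2))) rec-^
  where
  rec-^ : ∀ b e → rec 1 (λ acc _ → acc * b) e ≡ b ^ e
  rec-^ b zero    = refl
  rec-^ b (suc e) = trans (cong (_* b) (rec-^ b e)) (*-comm (b ^ e) b)

_^ᵉ_ : ∀ {n} → Exp n → Exp n → Exp n
a ^ᵉ b = call _^_ ^-primRec (a ∷ b ∷ [])

infix 0 if0_then_else_ if0ᵉ_then_else_

-- All tests below are ℕ-valued, with 0 meaning yes.

if0_then_else_ : ℕ → ℕ → ℕ → ℕ
if0 zero  then a else b = a
if0 suc _ then a else b = b

if0-primRec : PrimRec 3 if0_then_else_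
if0-primRec = primRec (loop (var (# 0)) (var (# 1)) (var (# 4)))
  λ { zero a b → refl ; (suc c) a b → refl }

if0ᵉ_then_else_ : ∀ {n} → Exp n → Exp n → Exp n → Exp n
if0ᵉ c then a else b = call if0_then_else_ if0-primRec (c ∷ a ∷ b ∷ [])

if0-≡0 : ∀ {c a b} → c ≡ 0 → (if0 c then a else b) ≡ a
if0-≡0 refl = refl

if0-≢0 : ∀ {c a b} → c ≢ 0 → (if0 c then a else b) ≡ b
if0-≢0 {zero}  c≢0 = ⊥-elim (c≢0 refl)
if0-≢0 {suc c} _   = refl

if0-≤ : ∀ {m n a b} → m ≤ n → (if0 m ∸ n then a else b) ≡ a
if0-≤ m≤n = if0-≡0 (m≤n⇒m∸n≡0 m≤n)

if0-> : ∀ {m n a b} → n < m → (if0 m ∸ n then a else b) ≡ b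
if0-> n<m = if0-≢0 (m>n⇒m∸n≢0 n<m)

outerVars : ∀ {n} k → Vec (Exp (k + n)) n
outerVars k = tabulate (var ∘ (k ↑ʳ_))

⟦outerVars⟧ : ∀ {n k} (ys : Vec ℕ k) (xs : Vec ℕ n) → ⟦ outerVars k ⟧* (ys ++ xs) ≡ xs
⟦outerVars⟧ {n} {k} ys xs =
  trans (⟦tabulate-var⟧ (k ↑ʳ_)) (trans (tabulate-cong (lookup-++ʳ ys xs)) (tabulate∘lookup xs))
  where
  ⟦tabulate-var⟧ : ∀ {m} (g : Fin m → Fin (k + n)) → ⟦ tabulate (var ∘ g) ⟧* (ys ++ xs) ≡ tabulate (lookup (ys ++ xs) ∘ g)
  ⟦tabulate-var⟧ {zero}  g = refl
  ⟦tabulate-var⟧ {suc m} g = cong (lookup (ys ++ xs) (g Fin.zero) ∷_) (⟦tabulate-var⟧ (g ∘ Fin.suc))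

accumulate : ∀ {n} → Op 3 → Op (suc n) → Op (suc n)
accumulate step P B = curryOp λ xs → rec 0 (λ acc i → step acc i (apply P (i ∷ xs))) B

accumulate-primRec : ∀ {n} {step : Op 3} {P : Op (suc n)} →
  PrimRec 3 step → PrimRec (suc n) P → PrimRec (suc n) (accumulate step P)
accumulate-primRec {n} {step} {P} step-pr P-pr = primRec body (≗apply⇒≗ⁿ spec)
  where
  body : Exp (suc n)
  body = loop (var (# 0)) (lit 0)
    (call step step-pr (var (# 0) ∷ var (# 1) ∷ call P P-pr (var (# 1) ∷ outerVars 3) ∷ []))
  spec : ∀ xs → ⟦ body ⟧ xs ≡ apply (accumulate step P) xs
  spec (B ∷ xs) = trans
    (rec-cong 0 (λ acc i → cong (λ ys → step acc i (apply P (i ∷ ys))) (⟦outerVars⟧ (acc ∷ i ∷ B ∷ []) xs)) B)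
    (sym (apply-curryOp _ xs))

minStep : ℕ → ℕ → ℕ → ℕ
minStep acc i p = if0 i ∸ acc then (if0 p then acc else suc acc) else acc

μ : (ℕ → ℕ) → ℕ → ℕ
μ P B = rec 0 (λ acc i → minStep acc i (P i)) B

μ-spec : ∀ P B → (μ P B ≡ B × (∀ i → i < B → P i ≢ 0))
               ⊎ (μ P B < B × P (μ P B) ≡ 0 × (∀ i → i < μ P B → P i ≢ 0))
μ-spec P zero = inj₁ (refl , λ i ())
μ-spec P (suc B) with μ-spec P B
... | inj₂ (μ<B , found , below) rewrite if0-> {B} {μ P B} {if0 P B then μ P B else suc (μ P B)} {μ P B} μ<B =
  inj₂ (m<n⇒m<1+n μ<B , found , below)
... | inj₁ (μ≡B , below) rewrite μ≡B | n∸n≡0 B with P B in eq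
...   | zero  = inj₂ (≤-refl , eq , below)
...   | suc _ = inj₁ (refl , below′)
  where
  below′ : ∀ i → i < suc B → P i ≢ 0
  below′ i i<1+B with m≤n⇒m<n∨m≡n (≤-pred i<1+B)
  ... | inj₁ i<B  = below i i<B
  ... | inj₂ refl = λ Pi≡0 → 0≢1+n (trans (sym Pi≡0) eq)

μ-minimal : ∀ P B {i} → i < μ P B → P i ≢ 0
μ-minimal P B {i} i<μ with μ-spec P B
... | inj₁ (μ≡B , below)     = below i (subst (i <_) μ≡B i<μ)
... | inj₂ (_ , _ , below)   = below i i<μ

μ-found : ∀ P B {x} → P x ≡ 0 → x < B → P (μ P B) ≡ 0
μ-found P B {x} Px≡0 x<B with μ-spec P B
... | inj₁ (_ , below)     = ⊥-elim (below x x<B Px≡0)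
... | inj₂ (_ , found , _) = found

μ-≡ : ∀ P B {x} → P x ≡ 0 → x < B → (∀ i → i < x → P i ≢ 0) → μ P B ≡ x
μ-≡ P B {x} Px≡0 x<B below with <-cmp (μ P B) x
... | tri< μ<x _ _ = ⊥-elim (below _ μ<x (μ-found P B Px≡0 x<B))
... | tri≈ _ μ≡x _ = μ≡x
... | tri> _ _ x<μ = ⊥-elim (μ-minimal P B x<μ Px≡0)

minStep-primRec : PrimRec 3 minStep
minStep-primRec = primRec
  (if0ᵉ var (# 1) ∸ᵉ var (# 0) then (if0ᵉ var (# 2) then var (# 0) else sucᵉ (var (# 0))) else var (# 0))
  λ acc i p → refl

boundedMin : ∀ {n} → Op (suc n) → Op (suc n)
boundedMin = accumulate minStep

boundedMin-primRec : ∀ {n} {P : Op (suc n)} → PrimRec (suc n) P → PrimRec (suc n) (boundedMin P)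
boundedMin-primRec = accumulate-primRec minStep-primRec

sumBelow : (ℕ → ℕ) → ℕ → ℕ
sumBelow g B = rec 0 (λ acc i → acc + g i) B

boundedSum : ∀ {n} → Op (suc n) → Op (suc n)
boundedSum = accumulate (λ acc _ p → acc + p)

boundedSum-primRec : ∀ {n} {P : Op (suc n)} → PrimRec (suc n) P → PrimRec (suc n) (boundedSum P)
boundedSum-primRec = accumulate-primRec (primRec (var (# 0) +ᵉ var (# 2)) λ acc i p → refl)

⊓-primRec : PrimRec 2 _⊓_
⊓-primRec = primRec (var (# 1) ∸ᵉ (var (# 1) ∸ᵉ var (# 0))) n∸[n∸m]≡m⊓n
  where
  n∸[n∸m]≡m⊓n : ∀ m n → n ∸ (n ∸ m) ≡ m ⊓ n
  n∸[n∸m]≡m⊓n m n = trans (cong (_∸ (n ∸ m)) (sym (m⊓n+n∸m≡n m n))) (m+n∸n≡m (m ⊓ n) (n ∸ m))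

_⊓ᵉ_ : ∀ {n} → Exp n → Exp n → Exp n
a ⊓ᵉ b = call _⊓_ ⊓-primRec (a ∷ b ∷ [])

f[m⊓n]⊓n≡f[m]⊓n : ∀ {f : ℕ → ℕ} → f Preserves _≤_ ⟶ _≤_ → (∀ x → x ≤ f x) →
  ∀ m n → f (m ⊓ n) ⊓ n ≡ f m ⊓ n
f[m⊓n]⊓n≡f[m]⊓n {f} mono infl m n with m ≤? n
... | yes m≤n rewrite m≤n⇒m⊓n≡m m≤n = refl
... | no m≰n  rewrite m≥n⇒m⊓n≡n (<⇒≤ (≰⇒> m≰n)) =
  trans (m≥n⇒m⊓n≡n (infl n)) (sym (m≥n⇒m⊓n≡n (≤-trans (<⇒≤ (≰⇒> m≰n)) (infl m))))

∣-∣-primRec : PrimRec 2 ∣_-_∣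
∣-∣-primRec = primRec ((var (# 0) ∸ᵉ var (# 1)) +ᵉ (var (# 1) ∸ᵉ var (# 0))) ∣m-n∣≡[m∸n]+[n∸m]
  where
  ∣m-n∣≡[m∸n]+[n∸m] : ∀ m n → (m ∸ n) + (n ∸ m) ≡ ∣ m - n ∣
  ∣m-n∣≡[m∸n]+[n∸m] m n with ≤-total m n
  ... | inj₁ m≤n rewrite m≤n⇒m∸n≡0 m≤n = sym (m≤n⇒∣m-n∣≡n∸m m≤n)
  ... | inj₂ n≤m rewrite m≤n⇒m∸n≡0 n≤m | ∣-∣-comm m n = trans (+-identityʳ _) (sym (m≤n⇒∣m-n∣≡n∸m n≤m))

∣-∣ᵉ : ∀ {n} → Exp n → Exp n → Exp n
∣-∣ᵉ a b = call ∣_-_∣ ∣-∣-primRec (a ∷ b ∷ [])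

-- Junk values: rem x 0 = 0 and quot x 0 = x.
rem : ℕ → ℕ → ℕ
rem x d = rec 0 (λ r _ → if0 d ∸ suc r then 0 else suc r) x

quot : ℕ → ℕ → ℕ
quot x d = rec 0 (λ q i → if0 d ∸ suc (rem i d) then suc q else q) x

rem-primRec : PrimRec 2 rem
rem-primRec = primRec
  (loop (var (# 0)) (lit 0) (if0ᵉ var (# 3) ∸ᵉ sucᵉ (var (# 0)) then lit 0 else sucᵉ (var (# 0))))
  λ x d → refl

remᵉ : ∀ {n} → Exp n → Exp n → Exp n
remᵉ a b = call rem rem-primRec (a ∷ b ∷ [])

quot-primRec : PrimRec 2 quot
quot-primRec = primRec
  (loop (var (# 0)) (lit 0) (if0ᵉ var (# 3) ∸ᵉ sucᵉ (remᵉ (var (# 1)) (var (# 3))) then sucᵉ (var (# 0)) else var (# 0)))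
  λ x d → refl

quotᵉ : ∀ {n} → Exp n → Exp n → Exp n
quotᵉ a b = call quot quot-primRec (a ∷ b ∷ [])

quot-rem-correct : ∀ x d → 0 < d → rem x d < d × quot x d * d + rem x d ≡ x
quot-rem-correct zero    d 0<d = 0<d , refl
quot-rem-correct (suc x) d 0<d with quot-rem-correct x d 0<d
... | r<d , eq with d ≤? suc (rem x d)
... | yes d≤1+r rewrite if0-≤ {d} {suc (rem x d)} {0} {suc (rem x d)} d≤1+r
                      | if0-≤ {d} {suc (rem x d)} {suc (quot x d)} {quot x d} d≤1+r = 0<d , wrap
  where
  wrap : suc (quot x d) * d + 0 ≡ suc x
  wrap = begin
    suc (quot x d) * d + 0     ≡⟨ +-identityʳ _ ⟩
    d + quot x d * d           ≡⟨ cong (_+ quot x d * d) (≤-antisym d≤1+r r<d) ⟩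
    suc (rem x d) + quot x d * d ≡⟨ cong suc (+-comm (rem x d) _) ⟩
    suc (quot x d * d + rem x d) ≡⟨ cong suc eq ⟩
    suc x ∎
    where open ≡-Reasoning
... | no d≰1+r rewrite if0-> {d} {suc (rem x d)} {0} {suc (rem x d)} (≰⇒> d≰1+r)
                     | if0-> {d} {suc (rem x d)} {suc (quot x d)} {quot x d} (≰⇒> d≰1+r) =
  ≰⇒> d≰1+r , trans (+-suc _ _) (cong suc eq)

quot-rem-unique : ∀ {x d q r} → r < d → q * d + r ≡ x → quot x d ≡ q × rem x d ≡ r
quot-rem-unique {x} {d} {q} {r} r<d eq with quot-rem-correct x d (≤-<-trans z≤n r<d)
... | r′<d , eq′ = quot≡q , +-cancelˡ-≡ (q * d) _ _ (trans (cong (λ u → u * d + rem x d) (sym quot≡q)) (trans eq′ (sym eq)))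
  where
  <-of-quot : ∀ {q r q′ r′} → q < q′ → r < d → q * d + r < q′ * d + r′
  <-of-quot {q} {r} {q′} {r′} q<q′ r<d = begin-strict
    q * d + r  <⟨ +-monoʳ-< (q * d) r<d ⟩
    q * d + d  ≡⟨ +-comm (q * d) d ⟩
    suc q * d  ≤⟨ *-monoˡ-≤ d q<q′ ⟩
    q′ * d     ≤⟨ m≤m+n _ r′ ⟩
    q′ * d + r′ ∎
    where open ≤-Reasoning
  quot≡q : quot x d ≡ q
  quot≡q with <-cmp (quot x d) q
  ... | tri< lt _ _ = ⊥-elim (<-irrefl (trans eq′ (sym eq)) (<-of-quot lt r′<d))
  ... | tri≈ _ e _  = e
  ... | tri> _ _ gt = ⊥-elim (<-irrefl (trans eq (sym eq′)) (<-of-quot gt r<d))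

digit : ℕ → ℕ → ℕ → ℕ
digit b y T = rem (quot T (b ^ y)) b

digit-primRec : PrimRec 3 digit
digit-primRec = primRec
  (remᵉ (quotᵉ (var (# 2)) (var (# 0) ^ᵉ var (# 1))) (var (# 0)))
  λ b y T → refl

digitᵉ : ∀ {n} → Exp n → Exp n → Exp n → Exp n
digitᵉ b y T = call digit digit-primRec (b ∷ y ∷ T ∷ [])

module _ (b : ℕ) (g : ℕ → ℕ) where

  numeralValue : ℕ → ℕ
  numeralValue = sumBelow (λ x → g x * b ^ x)

  numeralValue<b^N : ∀ N → (∀ x → x < N → g x < b) → numeralValue N < b ^ N
  numeralValue<b^N zero    g<b = s≤s z≤n
  numeralValue<b^N (suc N) g<b = begin-strict
    numeralValue N + g N * b ^ N  <⟨ +-monoˡ-< _ (numeralValue<b^N N (λ x x<N → g<b x (m<n⇒m<1+n x<N))) ⟩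
    suc (g N) * b ^ N             ≤⟨ *-monoˡ-≤ (b ^ N) (g<b N ≤-refl) ⟩
    b * b ^ N                     ∎
    where open ≤-Reasoning

  numeralValue-split : ∀ N y → (∀ x → x < N → g x < b) → y < N →
    ∃₂ λ L H → L < b ^ y × numeralValue N ≡ (g y + H * b) * b ^ y + L
  numeralValue-split (suc N) y g<b y<1+N with m≤n⇒m<n∨m≡n (≤-pred y<1+N)
  ... | inj₂ refl = numeralValue y , 0 , numeralValue<b^N y (λ x x<y → g<b x (m<n⇒m<1+n x<y)) ,
    trans (+-comm (numeralValue y) _) (cong (λ u → u * b ^ y + numeralValue y) (sym (+-identityʳ (g y))))
  ... | inj₁ y<N with numeralValue-split N y (λ x x<N → g<b x (m<n⇒m<1+n x<N)) y<N | m≤n⇒∃[o]m+o≡n y<N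
  ...   | L , H , L< , eq | o , refl = L , H + g (suc y + o) * b ^ o , L< , (begin
    numeralValue (suc y + o) + g (suc y + o) * b ^ (suc y + o)
      ≡⟨ cong₂ _+_ eq (cong (g (suc y + o) *_) (^-distribˡ-+-* b (suc y) o)) ⟩
    (g y + H * b) * b ^ y + L + g (suc y + o) * (b ^ suc y * b ^ o)
      ≡⟨ regroup (g y) H b (b ^ y) L (g (suc y + o)) (b ^ o) ⟩
    (g y + (H + g (suc y + o) * b ^ o) * b) * b ^ y + L ∎)
    where
    open ≡-Reasoning
    regroup : ∀ a H b p L c q → (a + H * b) * p + L + c * ((b * p) * q) ≡ (a + (H + c * q) * b) * p + L
    regroup = solve-∀

  digit-numeralValue : ∀ N y → (∀ x → x < N → g x < b) → y < N → digit b y (numeralValue N) ≡ g y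
  digit-numeralValue N y g<b y<N with numeralValue-split N y g<b y<N
  ... | L , H , L< , eq = trans (cong (λ u → rem u b) (proj₁ (quot-rem-unique {q = g y + H * b} L< (sym eq))))
                                (proj₂ (quot-rem-unique {q = H} (g<b y y<N) (+-comm (H * b) (g y))))

-- The fast-growing hierarchy

Inflationary : (ℕ → ℕ) → Set
Inflationary f = ∀ x → x < f x

module _ {f : ℕ → ℕ} where

  fold-inflationary : Inflationary f → ∀ x n → x ≤ fold x f n
  fold-inflationary infl x zero    = ≤-refl
  fold-inflationary infl x (suc n) = ≤-trans (fold-inflationary infl x n) (<⇒≤ (infl _))

  fold-monoˡ : f Preserves _≤_ ⟶ _≤_ → ∀ n → (λ x → fold x f n) Preserves _≤_ ⟶ _≤_
  fold-monoˡ mono zero    x≤y = x≤y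
  fold-monoˡ mono (suc n) x≤y = mono (fold-monoˡ mono n x≤y)

  fold-monoʳ : Inflationary f → ∀ x → (fold x f) Preserves _≤_ ⟶ _≤_
  fold-monoʳ infl x {n} m≤n with m≤n⇒∃[o]m+o≡n m≤n
  ... | o , refl = fold-+o n o
    where
    fold-+o : ∀ n o → fold x f n ≤ fold x f (n + o)
    fold-+o n zero    rewrite +-identityʳ n = ≤-refl
    fold-+o n (suc o) rewrite +-suc n o     = ≤-trans (fold-+o n o) (<⇒≤ (infl _))

fast : ℕ → ℕ → ℕ
fast zero    x = suc x
fast (suc m) x = fold x (fast m) (2 + x)

fast-inflationary : ∀ m → Inflationary (fast m)
fast-mono : ∀ m → fast m Preserves _≤_ ⟶ _≤_
fast-inflationary zero    x = ≤-refl
fast-inflationary (suc m) x =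
  ≤-trans (fast-inflationary m x) (fold-monoʳ (fast-inflationary m) x {1} {2 + x} (s≤s z≤n))
fast-mono zero    x≤y = s≤s x≤y
fast-mono (suc m) {x} {y} x≤y =
  ≤-trans (fold-monoˡ (fast-mono m) (2 + x) x≤y)
          (fold-monoʳ (fast-inflationary m) y (s≤s (s≤s x≤y)))

fast-monoˡ : ∀ x → (λ m → fast m x) Preserves _≤_ ⟶ _≤_
fast-monoˡ x {m} m≤n with m≤n⇒∃[o]m+o≡n m≤n
... | o , refl = fast-+o m o
  where
  fast-+o : ∀ m o → fast m x ≤ fast (m + o) x
  fast-+o m zero    rewrite +-identityʳ m = ≤-refl
  fast-+o m (suc o) rewrite +-suc m o     =
    ≤-trans (fast-+o m o) (fold-monoʳ (fast-inflationary (m + o)) x {1} {2 + x} (s≤s z≤n))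

fast-twice : ∀ m x → fast m (fast m x) ≤ fast (suc m) x
fast-twice m x = fold-monoʳ (fast-inflationary m) x {2} {2 + x} (s≤s (s≤s z≤n))

maxᵛ : ∀ {n} → Vec ℕ n → ℕ
maxᵛ = foldr′ _⊔_ 0

lookup≤maxᵛ : ∀ {n} (xs : Vec ℕ n) i → lookup xs i ≤ maxᵛ xs
lookup≤maxᵛ (x ∷ xs) Fin.zero    = m≤m⊔n x (maxᵛ xs)
lookup≤maxᵛ (x ∷ xs) (Fin.suc i) = ≤-trans (lookup≤maxᵛ xs i) (m≤n⊔m x (maxᵛ xs))

Majorised : ∀ {n} → (Vec ℕ n → ℕ) → Set
Majorised g = ∃ λ m → ∀ xs → g xs < fast m (maxᵛ xs)

mutual
  eval-majorised : ∀ {n} (t : PR n) → Majorised (eval t)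
  eval-majorised pzero     = 0 , λ xs → s≤s z≤n
  eval-majorised psucc     = 1 , λ { (x ∷ []) →
    subst (λ u → suc x < fast 1 u) (sym (⊔-identityʳ x))
          (s≤s (s≤s (fold-inflationary (fast-inflationary 0) x x))) }
  eval-majorised (pproj i) = 0 , λ xs → s≤s (lookup≤maxᵛ xs i)
  eval-majorised (pcomp f gs) with eval-majorised f | evalAll-majorised gs
  ... | a , f< | b , gs< = suc (a ⊔ b) , λ xs → begin-strict
    eval f (evalAll gs xs)          <⟨ f< _ ⟩
    fast a (maxᵛ (evalAll gs xs))   ≤⟨ fast-mono a (<⇒≤ (gs< xs)) ⟩
    fast a (fast b (maxᵛ xs))       ≤⟨ fast-monoˡ _ (m≤m⊔n a b) ⟩
    fast (a ⊔ b) (fast b (maxᵛ xs)) ≤⟨ fast-mono (a ⊔ b) (fast-monoˡ _ (m≤n⊔m a b)) ⟩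
    fast (a ⊔ b) (fast (a ⊔ b) (maxᵛ xs)) ≤⟨ fast-twice (a ⊔ b) _ ⟩
    fast (suc (a ⊔ b)) (maxᵛ xs)    ∎
    where open ≤-Reasoning
  eval-majorised (prec f g) with eval-majorised f | eval-majorised g
  ... | a , f< | b , g< = suc c , λ { (y ∷ xs) →
    <-≤-trans (prec< y xs) (fold-monoʳ (fast-inflationary c) _ (s≤s (≤-trans (m≤m⊔n y (maxᵛ xs)) (n≤1+n _)))) }
    where
    c : ℕ
    c = a ⊔ b
    prec< : ∀ y xs → eval (prec f g) (y ∷ xs) < fold (y ⊔ maxᵛ xs) (fast c) (suc y)
    prec< zero    xs = <-≤-trans (f< xs) (fast-monoˡ _ (m≤m⊔n a b))
    prec< (suc y) xs = <-≤-trans (g< _) (≤-trans (fast-monoˡ _ (m≤n⊔m a b)) (fast-mono c args≤))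
      where
      I : ℕ
      I = fold (suc y ⊔ maxᵛ xs) (fast c) (suc y)
      args≤ : eval (prec f g) (y ∷ xs) ⊔ (y ⊔ maxᵛ xs) ≤ I
      args≤ = ⊔-lub
        (≤-trans (<⇒≤ (prec< y xs)) (fold-monoˡ (fast-mono c) (suc y) (⊔-monoˡ-≤ (maxᵛ xs) (n≤1+n y))))
        (≤-trans (⊔-monoˡ-≤ (maxᵛ xs) (n≤1+n y)) (fold-inflationary (fast-inflationary c) _ (suc y)))

  evalAll-majorised : ∀ {n k} (ts : Vec (PR n) k) → Majorised (λ xs → maxᵛ (evalAll ts xs))
  evalAll-majorised []       = 0 , λ xs → s≤s z≤n
  evalAll-majorised (t ∷ ts) with eval-majorised t | evalAll-majorised ts
  ... | a , t< | b , ts< = a ⊔ b , λ xs →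
    ⊔-pres-<m (<-≤-trans (t< xs) (fast-monoˡ _ (m≤m⊔n a b))) (<-≤-trans (ts< xs) (fast-monoˡ _ (m≤n⊔m a b)))

-- Pairing and codes of triples

pair : ℕ → ℕ → ℕ
pair x y = (x + y) * (x + y) + y

pair-primRec : PrimRec 2 pair
pair-primRec = primRec (((var (# 0) +ᵉ var (# 1)) *ᵉ (var (# 0) +ᵉ var (# 1))) +ᵉ var (# 1)) λ x y → refl

pairᵉ : ∀ {n} → Exp n → Exp n → Exp n
pairᵉ a b = call pair pair-primRec (a ∷ b ∷ [])

pair-<-sum : ∀ {x y x′ y′} → x + y < x′ + y′ → pair x y < pair x′ y′
pair-<-sum {x} {y} {x′} {y′} lt = begin-strict
  (x + y) * (x + y) + y         ≤⟨ +-monoʳ-≤ ((x + y) * (x + y)) (m≤n+m y x) ⟩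
  (x + y) * (x + y) + (x + y)   <⟨ n<1+n _ ⟩
  suc ((x + y) * (x + y) + (x + y)) ≤⟨ s≤s (≤-trans (≤-reflexive (trans (+-comm _ (x + y)) (sym (*-suc (x + y) (x + y))))) (m≤n+m _ (x + y))) ⟩
  suc (x + y) * suc (x + y)     ≤⟨ *-mono-≤ lt lt ⟩
  (x′ + y′) * (x′ + y′)         ≤⟨ m≤m+n _ y′ ⟩
  pair x′ y′                    ∎
  where open ≤-Reasoning

pair-mono-≤-< : ∀ {x y x′ y′} → x ≤ x′ → y < y′ → pair x y < pair x′ y′
pair-mono-≤-< x≤x′ y<y′ =
  +-mono-≤-< (*-mono-≤ (+-mono-≤ x≤x′ (<⇒≤ y<y′)) (+-mono-≤ x≤x′ (<⇒≤ y<y′))) y<y′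

pair-injective : ∀ {x y x′ y′} → pair x y ≡ pair x′ y′ → x ≡ x′ × y ≡ y′
pair-injective {x} {y} {x′} {y′} eq with <-cmp (x + y) (x′ + y′)
... | tri< lt _ _ = ⊥-elim (<-irrefl eq (pair-<-sum {x} {y} {x′} {y′} lt))
... | tri> _ _ gt = ⊥-elim (<-irrefl (sym eq) (pair-<-sum {x′} {y′} {x} {y} gt))
... | tri≈ _ sum≡ _ = x≡x′ , y≡y′
  where
  y≡y′ : y ≡ y′
  y≡y′ = +-cancelˡ-≡ ((x + y) * (x + y)) y y′ (trans eq (cong (λ u → u * u + y′) (sym sum≡)))
  x≡x′ : x ≡ x′
  x≡x′ = +-cancelʳ-≡ y x x′ (trans sum≡ (cong (x′ +_) (sym y≡y′)))

m≤pair-m-n : ∀ x y → x ≤ pair x y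
m≤pair-m-n zero    y = z≤n
m≤pair-m-n (suc x) y =
  ≤-trans (m≤m+n (suc x) y) (≤-trans (m≤m*n (suc x + y) (suc x + y)) (m≤m+n _ y))

n≤pair-m-n : ∀ x y → y ≤ pair x y
n≤pair-m-n x y = m≤n+m y _

unpair₂-at : ℕ → ℕ → ℕ
unpair₂-at v x = μ (λ y → ∣ pair x y - v ∣) (suc v)

unpair₁ : ℕ → ℕ
unpair₁ v = μ (λ x → ∣ pair x (unpair₂-at v x) - v ∣) (suc v)

unpair₂ : ℕ → ℕ
unpair₂ v = unpair₂-at v (unpair₁ v)

unpair₂-at-pair : ∀ x y → unpair₂-at (pair x y) x ≡ y
unpair₂-at-pair x y = μ-≡ _ _ (∣n-n∣≡0 (pair x y)) (s≤s (n≤pair-m-n x y))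
  λ i i<y eq → <-irrefl (proj₂ (pair-injective {x} {i} {x} {y} (∣m-n∣≡0⇒m≡n eq))) i<y

unpair₁-pair : ∀ x y → unpair₁ (pair x y) ≡ x
unpair₁-pair x y = μ-≡ _ _
  (trans (cong (λ u → ∣ pair x u - pair x y ∣) (unpair₂-at-pair x y)) (∣n-n∣≡0 (pair x y)))
  (s≤s (m≤pair-m-n x y))
  λ i i<x eq → <-irrefl (proj₁ (pair-injective {i} {unpair₂-at (pair x y) i} {x} {y} (∣m-n∣≡0⇒m≡n eq))) i<x

unpair₂-pair : ∀ x y → unpair₂ (pair x y) ≡ y
unpair₂-pair x y = trans (cong (unpair₂-at (pair x y)) (unpair₁-pair x y)) (unpair₂-at-pair x y)

unpair₂-at-primRec : PrimRec 2 unpair₂-at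
unpair₂-at-primRec = primRec
  (call (boundedMin λ y v x → ∣ pair x y - v ∣)
        (boundedMin-primRec (primRec (∣-∣ᵉ (pairᵉ (var (# 2)) (var (# 0))) (var (# 1))) λ y v x → refl))
        (sucᵉ (var (# 0)) ∷ var (# 0) ∷ var (# 1) ∷ []))
  λ v x → refl

unpair₁-primRec : PrimRec 1 unpair₁
unpair₁-primRec = primRec
  (call (boundedMin λ x v → ∣ pair x (unpair₂-at v x) - v ∣)
        (boundedMin-primRec (primRec
          (∣-∣ᵉ (pairᵉ (var (# 0)) (call unpair₂-at unpair₂-at-primRec (var (# 1) ∷ var (# 0) ∷ []))) (var (# 1)))
          λ x v → refl))
        (sucᵉ (var (# 0)) ∷ var (# 0) ∷ []))
  λ v → refl

unpair₂-primRec : PrimRec 1 unpair₂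
unpair₂-primRec = primRec
  (call unpair₂-at unpair₂-at-primRec (var (# 0) ∷ call unpair₁ unpair₁-primRec (var (# 0) ∷ []) ∷ []))
  λ v → refl

encode : ℕ → ℕ → ℕ → ℕ
encode k s j = suc (pair k (pair s j))

encode-primRec : PrimRec 3 encode
encode-primRec = primRec (sucᵉ (pairᵉ (var (# 0)) (pairᵉ (var (# 1)) (var (# 2))))) λ k s j → refl

chunkOf blockOf offsetOf : ℕ → ℕ
chunkOf  v = unpair₁ (pred v)
blockOf  v = unpair₁ (unpair₂ (pred v))
offsetOf v = unpair₂ (unpair₂ (pred v))

module _ {A : Set} (F : ℕ → ℕ → ℕ → A) where

  decode : ℕ → A
  decode v = F (chunkOf v) (blockOf v) (offsetOf v)

  decode-encode : ∀ k s j → decode (encode k s j) ≡ F k s j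
  decode-encode k s j = begin
    F (unpair₁ w) (unpair₁ (unpair₂ w)) (unpair₂ (unpair₂ w))
      ≡⟨ cong (λ u → F u (unpair₁ (unpair₂ w)) (unpair₂ (unpair₂ w))) (unpair₁-pair k (pair s j)) ⟩
    F k (unpair₁ (unpair₂ w)) (unpair₂ (unpair₂ w))
      ≡⟨ cong (λ w′ → F k (unpair₁ w′) (unpair₂ w′)) (unpair₂-pair k (pair s j)) ⟩
    F k (unpair₁ (pair s j)) (unpair₂ (pair s j))
      ≡⟨ cong₂ (F k) (unpair₁-pair s j) (unpair₂-pair s j) ⟩
    F k s j ∎
    where
    open ≡-Reasoning
    w : ℕ
    w = pair k (pair s j)

chunkOf-primRec : PrimRec 1 chunkOf
chunkOf-primRec = primRec (call unpair₁ unpair₁-primRec (call pred pred-primRec (var (# 0) ∷ []) ∷ [])) λ v → refl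

blockOf-primRec : PrimRec 1 blockOf
blockOf-primRec = primRec
  (call unpair₁ unpair₁-primRec (call unpair₂ unpair₂-primRec (call pred pred-primRec (var (# 0) ∷ []) ∷ []) ∷ []))
  λ v → refl

offsetOf-primRec : PrimRec 1 offsetOf
offsetOf-primRec = primRec
  (call unpair₂ unpair₂-primRec (call unpair₂ unpair₂-primRec (call pred pred-primRec (var (# 0) ∷ []) ∷ []) ∷ []))
  λ v → refl

decode-primRec : ∀ {F : Op 3} → PrimRec 3 F → PrimRec 1 (decode F)
decode-primRec {F} F-pr = primRec
  (call F F-pr (call chunkOf chunkOf-primRec (var (# 0) ∷ []) ∷ call blockOf blockOf-primRec (var (# 0) ∷ [])
                ∷ call offsetOf offsetOf-primRec (var (# 0) ∷ []) ∷ []))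
  λ v → refl

decodeᵉ : ∀ {n} (F : Op 3) → PrimRec 3 F → Exp n → Exp n
decodeᵉ F F-pr v = call (decode F) (decode-primRec F-pr) (v ∷ [])

-- The capped hierarchy

-- table m B holds fast m x ⊓ suc B, for x < 2 + B, as the digits of a numeral in base 2 + B; so the
-- recursion on the level m runs over numbers instead of functions.
initialTable : ℕ → ℕ
initialTable B = numeralValue (2 + B) (λ x → suc x ⊓ suc B) (2 + B)

iterateDigits : ℕ → ℕ → ℕ → ℕ → ℕ
iterateDigits B T n z = rec z (λ v _ → digit (2 + B) v T) n

nextTable : ℕ → ℕ → ℕ
nextTable B T = numeralValue (2 + B) (λ x → iterateDigits B T (2 + x) x) (2 + B)

table : ℕ → ℕ → ℕ
table m B = rec (initialTable B) (λ T _ → nextTable B T) m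

table-digit : ∀ B m x → x < 2 + B → digit (2 + B) x (table m B) ≡ fast m x ⊓ suc B
table-digit B zero x x<2+B =
  digit-numeralValue (2 + B) (λ x → suc x ⊓ suc B) (2 + B) x (λ y _ → s≤s (m⊓n≤n _ _)) x<2+B
table-digit B (suc m) x x<2+B =
  trans (digit-numeralValue (2 + B) (λ x → iterateDigits B (table m B) (2 + x) x) (2 + B) x
           (λ y y<2+B → subst (_< 2 + B) (sym (iterateDigits-fold (2 + y) y y<2+B)) (s≤s (m⊓n≤n _ _)))
           x<2+B)
        (iterateDigits-fold (2 + x) x x<2+B)
  where
  iterateDigits-fold : ∀ n z → z < 2 + B → iterateDigits B (table m B) n z ≡ fold z (fast m) n ⊓ suc B
  iterateDigits-fold zero    z z<2+B = sym (m≤n⇒m⊓n≡m (≤-pred z<2+B))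
  iterateDigits-fold (suc n) z z<2+B = begin
    digit (2 + B) (iterateDigits B (table m B) n z) (table m B)
      ≡⟨ cong (λ v → digit (2 + B) v (table m B)) (iterateDigits-fold n z z<2+B) ⟩
    digit (2 + B) (fold z (fast m) n ⊓ suc B) (table m B)
      ≡⟨ table-digit B m _ (s≤s (m⊓n≤n _ _)) ⟩
    fast m (fold z (fast m) n ⊓ suc B) ⊓ suc B
      ≡⟨ f[m⊓n]⊓n≡f[m]⊓n (fast-mono m) (λ x → <⇒≤ (fast-inflationary m x)) _ _ ⟩
    fold z (fast m) (suc n) ⊓ suc B ∎
    where open ≡-Reasoning

table-primRec : PrimRec 2 table
table-primRec = primRec
  (loop (var (# 0))
    (call (boundedSum λ x B → (suc x ⊓ suc B) * (2 + B) ^ x) initial-pr (base (var (# 1)) ∷ var (# 1) ∷ []))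
    (call (boundedSum λ x T B → iterateDigits B T (2 + x) x * (2 + B) ^ x) next-pr
          (base (var (# 3)) ∷ var (# 0) ∷ var (# 3) ∷ [])))
  λ m B → refl
  where
  base : ∀ {n} → Exp n → Exp n
  base B = sucᵉ (sucᵉ B)
  initial-pr : PrimRec 2 (boundedSum λ x B → (suc x ⊓ suc B) * (2 + B) ^ x)
  initial-pr = boundedSum-primRec (primRec ((sucᵉ (var (# 0)) ⊓ᵉ sucᵉ (var (# 1))) *ᵉ (base (var (# 1)) ^ᵉ var (# 0)))
    λ x B → refl)
  iterateDigits-pr : PrimRec 4 iterateDigits
  iterateDigits-pr = primRec (loop (var (# 2)) (var (# 3)) (digitᵉ (base (var (# 2))) (var (# 0)) (var (# 3))))
    λ B T n z → refl
  next-pr : PrimRec 3 (boundedSum λ x T B → iterateDigits B T (2 + x) x * (2 + B) ^ x)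
  next-pr = boundedSum-primRec (primRec
    (call iterateDigits iterateDigits-pr (var (# 2) ∷ var (# 1) ∷ base (var (# 0)) ∷ var (# 0) ∷ [])
      *ᵉ (base (var (# 2)) ^ᵉ var (# 0)))
    λ x T B → refl)

fastCapped : ℕ → ℕ → ℕ → ℕ
fastCapped m x B = if0 x ∸ suc B then digit (2 + B) x (table m B) else suc B

fastCapped-correct : ∀ m x B → fastCapped m x B ≡ fast m x ⊓ suc B
fastCapped-correct m x B with x ≤? suc B
... | yes x≤1+B = trans (if0-≤ x≤1+B) (table-digit B m x (s≤s x≤1+B))
... | no x≰1+B  = trans (if0-> (≰⇒> x≰1+B)) (sym (m≥n⇒m⊓n≡n (<⇒≤ (<-trans (≰⇒> x≰1+B) (fast-inflationary m x)))))

fastCapped-primRec : PrimRec 3 fastCapped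
fastCapped-primRec = primRec
  (if0ᵉ var (# 1) ∸ᵉ sucᵉ (var (# 2))
   then digitᵉ (sucᵉ (sucᵉ (var (# 2)))) (var (# 1)) (call table table-primRec (var (# 0) ∷ var (# 2) ∷ []))
   else sucᵉ (var (# 2)))
  λ m x B → refl

-- The chunks

-- encode (suc k) 1 0 is the code of Y (suc k) (c[Y]≤encode); rough-slope-not-primRec uses that
-- Y (suc k) ≥ Z k dominates fast (suc k) there.
mutual
  Y : ℕ → ℕ
  Y zero    = 1
  Y (suc k) = Y k * Z k

  Z : ℕ → ℕ
  Z k = fast (suc k) (Y k + encode (suc k) 1 0)

Y+encode<Z : ∀ k → Y k + encode (suc k) 1 0 < Z k
Y+encode<Z k = fast-inflationary (suc k) _

Y>0 : ∀ k → 0 < Y k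
Y>0 zero    = s≤s z≤n
Y>0 (suc k) = *-mono-< (Y>0 k) (<-trans (Y>0 k) (≤-<-trans (m≤m+n (Y k) _) (Y+encode<Z k)))

Y<Z : ∀ k → Y k < Z k
Y<Z k = ≤-<-trans (m≤m+n (Y k) _) (Y+encode<Z k)

Y<Y[1+k] : ∀ k → Y k < Y (suc k)
Y<Y[1+k] k = subst (_< Y k * Z k) (*-identityʳ (Y k))
  (*-monoʳ-< (Y k) {{>-nonZero (Y>0 k)}} (≤-<-trans (Y>0 k) (Y<Z k)))

Y-mono-< : ∀ {k k′} → k < k′ → Y k < Y k′
Y-mono-< {k} {suc k′} (s≤s k≤k′) with m≤n⇒m<n∨m≡n k≤k′
... | inj₁ k<k′ = <-trans (Y-mono-< k<k′) (Y<Y[1+k] k′)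
... | inj₂ refl = Y<Y[1+k] k

Y-mono-≤ : ∀ {k k′} → k ≤ k′ → Y k ≤ Y k′
Y-mono-≤ k≤k′ with m≤n⇒m<n∨m≡n k≤k′
... | inj₁ k<k′ = <⇒≤ (Y-mono-< k<k′)
... | inj₂ refl = ≤-refl

n<Y[n] : ∀ k → k < Y k
n<Y[n] zero    = s≤s z≤n
n<Y[n] (suc k) = ≤-<-trans (n<Y[n] k) (Y<Y[1+k] k)

Yᶜ : ℕ → ℕ → ℕ
Yᶜ k B = rec (1 ⊓ suc B)
  (λ y i → if0 y ∸ B then (y * fastCapped (suc i) (y + encode (suc i) 1 0) B) ⊓ suc B else suc B) k

Yᶜ-correct : ∀ k B → Yᶜ k B ≡ Y k ⊓ suc B
Yᶜ-correct zero    B = refl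
Yᶜ-correct (suc k) B rewrite Yᶜ-correct k B with Y k ≤? B
... | yes Y≤B rewrite m≤n⇒m⊓n≡m (m≤n⇒m≤1+n Y≤B) = begin
  (if0 Y k ∸ B then (Y k * fastCapped (suc k) (Y k + e) B) ⊓ suc B else suc B)
    ≡⟨ if0-≤ Y≤B ⟩
  (Y k * fastCapped (suc k) (Y k + e) B) ⊓ suc B
    ≡⟨ cong (λ u → (Y k * u) ⊓ suc B) (fastCapped-correct (suc k) (Y k + e) B) ⟩
  (Y k * (Z k ⊓ suc B)) ⊓ suc B
    ≡⟨ f[m⊓n]⊓n≡f[m]⊓n (*-monoʳ-≤ (Y k)) (λ x → m≤n*m x (Y k) {{>-nonZero (Y>0 k)}}) (Z k) (suc B) ⟩
  Y (suc k) ⊓ suc B ∎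
  where
  open ≡-Reasoning
  e : ℕ
  e = encode (suc k) 1 0
... | no Y≰B rewrite m≥n⇒m⊓n≡n (≰⇒> Y≰B) =
  trans (if0-> {suc B} {B} ≤-refl) (sym (m≥n⇒m⊓n≡n (≤-trans (≰⇒> Y≰B) (<⇒≤ (Y<Y[1+k] k)))))

Zᶜ : ℕ → ℕ → ℕ
Zᶜ k B = fastCapped (suc k) (Yᶜ k B + encode (suc k) 1 0) B

Zᶜ-correct : ∀ k B → Zᶜ k B ≡ Z k ⊓ suc B
Zᶜ-correct k B = begin
  fastCapped (suc k) (Yᶜ k B + e) B    ≡⟨ fastCapped-correct (suc k) (Yᶜ k B + e) B ⟩
  fast (suc k) (Yᶜ k B + e) ⊓ suc B    ≡⟨ cong (λ y → fast (suc k) (y + e) ⊓ suc B) (Yᶜ-correct k B) ⟩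
  fast (suc k) (Y k ⊓ suc B + e) ⊓ suc B ≡⟨ f[m⊓n]⊓n≡f[m]⊓n mono infl (Y k) (suc B) ⟩
  Z k ⊓ suc B ∎
  where
  open ≡-Reasoning
  e : ℕ
  e = encode (suc k) 1 0
  mono : (λ y → fast (suc k) (y + e)) Preserves _≤_ ⟶ _≤_
  mono y≤y′ = fast-mono (suc k) (+-monoˡ-≤ e y≤y′)
  infl : ∀ y → y ≤ fast (suc k) (y + e)
  infl y = ≤-trans (m≤m+n y e) (<⇒≤ (fast-inflationary (suc k) _))

Yᶜ-primRec : PrimRec 2 Yᶜ
Yᶜ-primRec = primRec
  (loop (var (# 0)) (lit 1 ⊓ᵉ sucᵉ (var (# 1)))
    (if0ᵉ var (# 0) ∸ᵉ var (# 3)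
     then (var (# 0) *ᵉ call fastCapped fastCapped-primRec
             (sucᵉ (var (# 1)) ∷ (var (# 0) +ᵉ e (sucᵉ (var (# 1)))) ∷ var (# 3) ∷ [])) ⊓ᵉ sucᵉ (var (# 3))
     else sucᵉ (var (# 3))))
  λ k B → refl
  where
  e : ∀ {n} → Exp n → Exp n
  e k = call encode encode-primRec (k ∷ lit 1 ∷ lit 0 ∷ [])

Zᶜ-primRec : PrimRec 2 Zᶜ
Zᶜ-primRec = primRec
  (call fastCapped fastCapped-primRec
    (sucᵉ (var (# 0))
     ∷ call Yᶜ Yᶜ-primRec (var (# 0) ∷ var (# 1) ∷ []) +ᵉ call encode encode-primRec (sucᵉ (var (# 0)) ∷ lit 1 ∷ lit 0 ∷ [])
     ∷ var (# 1) ∷ []))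
  λ k B → refl

<-test : ℕ → ℕ → ℕ
<-test j n = suc j ∸ n

<-test≡0⇒< : ∀ j n → <-test j n ≡ 0 → j < n
<-test≡0⇒< j n = m∸n≡0⇒m≤n

<⇒<-test≡0 : ∀ {j n} → j < n → <-test j n ≡ 0
<⇒<-test≡0 = m≤n⇒m∸n≡0

<-test⊓⇒< : ∀ j n → <-test j (n ⊓ suc j) ≡ 0 → j < n
<-test⊓⇒< j n eq = m<n⊓o⇒m<n n (suc j) (<-test≡0⇒< j _ eq)

<⇒<-test⊓ : ∀ {j n} → j < n → <-test j (n ⊓ suc j) ≡ 0
<⇒<-test⊓ j<n = <⇒<-test≡0 (⊓-pres-m< j<n ≤-refl)

≥-test⊓⇒≥ : ∀ j n → (n ⊓ suc j) ∸ j ≡ 0 → n ≤ j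
≥-test⊓⇒≥ j n eq with ≤-total n (suc j)
... | inj₁ n≤1+j = subst (_≤ j) (m≤n⇒m⊓n≡m n≤1+j) (m∸n≡0⇒m≤n eq)
... | inj₂ 1+j≤n = ⊥-elim (<-irrefl refl (subst (_≤ j) (m≥n⇒m⊓n≡n 1+j≤n) (m∸n≡0⇒m≤n eq)))

≥⇒≥-test⊓ : ∀ {j n} → n ≤ j → (n ⊓ suc j) ∸ j ≡ 0
≥⇒≥-test⊓ {j} {n} n≤j = m≤n⇒m∸n≡0 (≤-trans (m⊓n≤m n (suc j)) n≤j)

below-Y? : ℕ → ℕ → ℕ
below-Y? k j = <-test j (Yᶜ k j)

below-Y?⇒< : ∀ k j → below-Y? k j ≡ 0 → j < Y k
below-Y?⇒< k j eq = <-test⊓⇒< j (Y k) (subst (λ y → <-test j y ≡ 0) (Yᶜ-correct k j) eq)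

<⇒below-Y? : ∀ k {j} → j < Y k → below-Y? k j ≡ 0
<⇒below-Y? k {j} j<Y = subst (λ y → <-test j y ≡ 0) (sym (Yᶜ-correct k j)) (<⇒<-test⊓ j<Y)

below-Z? : ℕ → ℕ → ℕ
below-Z? k s = <-test s (Zᶜ k s)

below-Z?⇒< : ∀ k s → below-Z? k s ≡ 0 → s < Z k
below-Z?⇒< k s eq = <-test⊓⇒< s (Z k) (subst (λ z → <-test s z ≡ 0) (Zᶜ-correct k s) eq)

<⇒below-Z? : ∀ k {s} → s < Z k → below-Z? k s ≡ 0
<⇒below-Z? k {s} s<Z = subst (λ z → <-test s z ≡ 0) (sym (Zᶜ-correct k s)) (<⇒<-test⊓ s<Z)

Yᶜ-exact : ∀ k {B} → Y k ≤ B → Yᶜ k B ≡ Y k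
Yᶜ-exact k {B} Y≤B = trans (Yᶜ-correct k B) (m≤n⇒m⊓n≡m (m≤n⇒m≤1+n Y≤B))

below-Y?-primRec : PrimRec 2 below-Y?
below-Y?-primRec = primRec (sucᵉ (var (# 1)) ∸ᵉ call Yᶜ Yᶜ-primRec (var (# 0) ∷ var (# 1) ∷ [])) λ k j → refl

below-Z?-primRec : PrimRec 2 below-Z?
below-Z?-primRec = primRec (sucᵉ (var (# 1)) ∸ᵉ call Zᶜ Zᶜ-primRec (var (# 0) ∷ var (# 1) ∷ [])) λ k s → refl

reaches-Y? : ℕ → ℕ → ℕ
reaches-Y? k j = Yᶜ k j ∸ j

reaches-Y?⇒≥ : ∀ k j → reaches-Y? k j ≡ 0 → Y k ≤ j
reaches-Y?⇒≥ k j eq = ≥-test⊓⇒≥ j (Y k) (subst (λ y → y ∸ j ≡ 0) (Yᶜ-correct k j) eq)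

≥⇒reaches-Y? : ∀ k {j} → Y k ≤ j → reaches-Y? k j ≡ 0
≥⇒reaches-Y? k {j} Y≤j = subst (λ y → y ∸ j ≡ 0) (sym (Yᶜ-correct k j)) (≥⇒≥-test⊓ Y≤j)

reaches-Y?-primRec : PrimRec 2 reaches-Y?
reaches-Y?-primRec = primRec (call Yᶜ Yᶜ-primRec (var (# 0) ∷ var (# 1) ∷ []) ∸ᵉ var (# 1)) λ k j → refl

rem≡% : ∀ x d → rem x (suc d) ≡ x % suc d
rem≡% x d = proj₂ (quot-rem-unique {q = x / suc d} (m%n<n x (suc d)) (sym (trans (m≡m%n+[m/n]*n x (suc d)) (+-comm (x % suc d) _))))

smooth? : ℕ → ℕ → ℕ
smooth? M s = if0 s then 1 else rem (M ^ s) s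

smooth?-primRec : PrimRec 2 smooth?
smooth?-primRec = primRec (if0ᵉ var (# 1) then lit 1 else remᵉ (var (# 0) ^ᵉ var (# 1)) (var (# 1))) λ M s → refl

smooth?-sound : ∀ M s → smooth? M s ≡ 0 → 0 < s × s ∣ M ^ s
smooth?-sound M (suc s) eq = s≤s z≤n , m%n≡0⇒n∣m (M ^ suc s) (suc s) (trans (sym (rem≡% (M ^ suc s) s)) eq)

smooth?-complete : ∀ M s → 0 < s → s ∣ M ^ s → smooth? M s ≡ 0
smooth?-complete M (suc s) _ s∣M^s = trans (rem≡% (M ^ suc s) s) (n∣m⇒m%n≡0 (M ^ suc s) (suc s) s∣M^s)

smooth?-1 : ∀ M → smooth? M 1 ≡ 0
smooth?-1 M = smooth?-complete M 1 ≤-refl (divides (M ^ 1) (sym (*-identityʳ _)))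

smooth?-* : ∀ M {q} s → q ∣ M → 2 ≤ q → smooth? M s ≡ 0 → smooth? M (q * s) ≡ 0
smooth?-* M {q} s q∣M 2≤q smooth with smooth?-sound M s smooth
... | 0<s , s∣M^s = smooth?-complete M (q * s) (*-mono-≤ (≤-trans (s≤s z≤n) 2≤q) 0<s)
  (∣-trans (*-pres-∣ q∣M s∣M^s) (M^m∣M^n (1+s≤q*s)))
  where
  M^m∣M^n : ∀ {m n} → m ≤ n → M ^ m ∣ M ^ n
  M^m∣M^n {m} m≤n with m≤n⇒∃[o]m+o≡n m≤n
  ... | o , refl = divides (M ^ o) (trans (^-distribˡ-+-* M m o) (*-comm (M ^ m) (M ^ o)))
  1+s≤q*s : suc s ≤ q * s
  1+s≤q*s = begin
    suc s   ≤⟨ +-monoˡ-≤ s 0<s ⟩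
    s + s   ≡⟨ cong (s +_) (sym (+-identityʳ s)) ⟩
    2 * s   ≤⟨ *-monoˡ-≤ s 2≤q ⟩
    q * s   ∎
    where open ≤-Reasoning

prime∣m^n⇒prime∣m : ∀ {p} m n → Prime p → p ∣ m ^ n → p ∣ m
prime∣m^n⇒prime∣m m zero    pp p∣1   = ⊥-elim (¬prime[1] (subst Prime (∣1⇒≡1 p∣1) pp))
prime∣m^n⇒prime∣m m (suc n) pp p∣m^n with euclidsLemma m (m ^ n) pp p∣m^n
... | inj₁ p∣m   = p∣m
... | inj₂ p∣m^n = prime∣m^n⇒prime∣m m n pp p∣m^n

smooth?-prime-factor : ∀ {P} → All Prime P → ∀ {q a} → Prime q → q ∣ a → smooth? (product P) a ≡ 0 → q ∈ P
smooth?-prime-factor {P} ps {q} {a} pq q∣a smooth =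
  factorisationHasAllPrimeFactors pq
    (prime∣m^n⇒prime∣m (product P) a pq (∣-trans q∣a (proj₂ (smooth?-sound (product P) a smooth)))) ps

smooth?-*-closed : ∀ {P} → All Prime P → ∀ a → 0 < a → (∀ q → Prime q → q ∣ a → q ∈ P) →
  ∀ s → smooth? (product P) s ≡ 0 → smooth? (product P) (a * s) ≡ 0
smooth?-*-closed {P} ps a 0<a factors∈P s smooth =
  subst (λ n → smooth? (product P) (n * s) ≡ 0) (sym isFactorisation)
    (product-closed factors (λ q∈ → All.lookup factorsPrime q∈ , q∈P q∈))
  where
  open PrimeFactorisation (factorise a {{>-nonZero 0<a}})
  q∈P : ∀ {q} → q ∈ factors → q ∈ P
  q∈P {q} q∈ = factors∈P q (All.lookup factorsPrime q∈) (subst (q ∣_) (sym isFactorisation) (∈⇒∣product q∈))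
  product-closed : ∀ qs → (∀ {q} → q ∈ qs → Prime q × q ∈ P) → smooth? (product P) (product qs * s) ≡ 0
  product-closed []       _  = subst (λ n → smooth? (product P) n ≡ 0) (sym (+-identityʳ s)) smooth
  product-closed (q ∷ qs) ok =
    subst (λ n → smooth? (product P) n ≡ 0) (sym (*-assoc q (product qs) s))
      (smooth?-* (product P) (product qs * s) (∈⇒∣product (proj₂ (ok (here refl))))
        (nonTrivial⇒n>1 q {{prime⇒nonTrivial (proj₁ (ok (here refl)))}})
        (product-closed qs (ok ∘ there)))

-- Positions and codes

module Coding (M : ℕ) where

  chunk : ℕ → ℕ
  chunk n = μ (λ k → below-Y? (suc k) n) (suc n)

  chunk-primRec : PrimRec 1 chunk
  chunk-primRec = primRec
    (call (boundedMin λ k n → below-Y? (suc k) n)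
          (boundedMin-primRec (primRec (call below-Y? below-Y?-primRec (sucᵉ (var (# 0)) ∷ var (# 1) ∷ [])) λ k n → refl))
          (sucᵉ (var (# 0)) ∷ var (# 0) ∷ []))
    λ n → refl

  chunk-bounds : ∀ n → 0 < n → Y (chunk n) ≤ n × n < Y (suc (chunk n))
  chunk-bounds n 0<n =
    lower (chunk n) (λ i i<c → μ-minimal P (suc n) i<c ∘ <⇒below-Y? (suc i)) ,
    below-Y?⇒< (suc (chunk n)) n (μ-found P (suc n) (<⇒below-Y? (suc n) (<-trans (n<Y[n] n) (Y<Y[1+k] n))) ≤-refl)
    where
    P : ℕ → ℕ
    P k = below-Y? (suc k) n
    lower : ∀ c → (∀ i → i < c → ¬ n < Y (suc i)) → Y c ≤ n
    lower zero    _     = 0<n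
    lower (suc c) above = ≮⇒≥ (above c ≤-refl)

  chunk-unique : ∀ n k → Y k ≤ n → n < Y (suc k) → chunk n ≡ k
  chunk-unique n k Y≤n n<Y = μ-≡ (λ k → below-Y? (suc k) n) (suc n) (<⇒below-Y? (suc k) n<Y) (s≤s (≤-trans (<⇒≤ (n<Y[n] k)) Y≤n))
    λ i i<k eq → <⇒≱ (below-Y?⇒< (suc i) n eq) (≤-trans (Y-mono-≤ i<k) Y≤n)

  smooth?ₘ-primRec : PrimRec 1 (smooth? M)
  smooth?ₘ-primRec = primRec (call smooth? smooth?-primRec (lit M ∷ var (# 0) ∷ [])) λ s → refl

  -- Offsets in rough blocks are shifted by Y k, so their codes lie above those of the first block.
  offset : ℕ → ℕ → ℕ → ℕ
  offset y s i = if0 smooth? M s then i else y + i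

  offset-primRec : PrimRec 3 offset
  offset-primRec = primRec
    (if0ᵉ call (smooth? M) smooth?ₘ-primRec (var (# 1) ∷ []) then var (# 2) else var (# 0) +ᵉ var (# 2))
    λ y s i → refl

  inner : ℕ → ℕ → ℕ → ℕ
  inner y s j = if0 smooth? M s then j else j ∸ y

  position : ℕ → ℕ → ℕ → ℕ
  position y s j = s * y + inner y s j

  position-primRec : PrimRec 3 position
  position-primRec = primRec
    (var (# 1) *ᵉ var (# 0) +ᵉ (if0ᵉ call (smooth? M) smooth?ₘ-primRec (var (# 1) ∷ []) then var (# 2) else var (# 2) ∸ᵉ var (# 0)))
    λ y s j → refl

  OffsetOK : ℕ → ℕ → ℕ → Set
  OffsetOK k s j = smooth? M s ≡ 0 × j < Y k ⊎ smooth? M s ≢ 0 × Y k ≤ j × j < Y k + Y k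

  Valid : ℕ → ℕ → ℕ → Set
  Valid k s j = 0 < s × s < Z k × OffsetOK k s j

  inner<Y : ∀ k s j → Valid k s j → inner (Y k) s j < Y k
  inner<Y k s j (_ , _ , inj₁ (smooth , j<Y)) rewrite smooth = j<Y
  inner<Y k s j (_ , _ , inj₂ (rough , Y≤j , j<2Y)) rewrite if0-≢0 {smooth? M s} {j} {j ∸ Y k} rough =
    +-cancelˡ-< (Y k) (j ∸ Y k) (Y k) (subst (_< Y k + Y k) (sym (m+[n∸m]≡n Y≤j)) j<2Y)

  offset-inner : ∀ k s j → Valid k s j → offset (Y k) s (inner (Y k) s j) ≡ j
  offset-inner k s j (_ , _ , inj₁ (smooth , _)) rewrite smooth = refl
  offset-inner k s j (_ , _ , inj₂ (rough , Y≤j , _))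
    rewrite if0-≢0 {smooth? M s} {j} {j ∸ Y k} rough | if0-≢0 {smooth? M s} {j ∸ Y k} {Y k + (j ∸ Y k)} rough =
    m+[n∸m]≡n Y≤j

  s*Y+i<Y[1+k] : ∀ k {s i} → s < Z k → i < Y k → s * Y k + i < Y (suc k)
  s*Y+i<Y[1+k] k {s} {i} s<Z i<Y = begin-strict
    s * Y k + i   <⟨ +-monoʳ-< (s * Y k) i<Y ⟩
    s * Y k + Y k ≡⟨ +-comm (s * Y k) (Y k) ⟩
    suc s * Y k   ≤⟨ *-monoˡ-≤ (Y k) s<Z ⟩
    Z k * Y k     ≡⟨ *-comm (Z k) (Y k) ⟩
    Y (suc k)     ∎
    where open ≤-Reasoning

  offset-valid : ∀ k s i → 0 < s → s < Z k → i < Y k →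
    Valid k s (offset (Y k) s i) × inner (Y k) s (offset (Y k) s i) ≡ i
  offset-valid k s i 0<s s<Z i<Y with smooth? M s
  ... | zero  = (0<s , s<Z , inj₁ (refl , i<Y)) , refl
  ... | suc _ = (0<s , s<Z , inj₂ ((λ ()) , m≤m+n (Y k) i , +-monoʳ-< (Y k) i<Y)) , m+n∸m≡n (Y k) i

  decompose : ∀ n → 0 < n → ∃ λ k → ∃₂ λ s j → Valid k s j × position (Y k) s j ≡ n
  decompose n 0<n = k , s , offset (Y k) s i , proj₁ valid , trans (cong (s * Y k +_) (proj₂ valid)) s*Y+i≡n
    where
    k s i : ℕ
    k = chunk n
    s = quot n (Y k)
    i = rem n (Y k)
    Y≤n : Y k ≤ n
    Y≤n = proj₁ (chunk-bounds n 0<n)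
    n<Y : n < Y (suc k)
    n<Y = proj₂ (chunk-bounds n 0<n)
    i<Y : i < Y k
    i<Y = proj₁ (quot-rem-correct n (Y k) (Y>0 k))
    s*Y+i≡n : s * Y k + i ≡ n
    s*Y+i≡n = proj₂ (quot-rem-correct n (Y k) (Y>0 k))
    0<s : 0 < s
    0<s = n≢0⇒n>0 λ s≡0 → <⇒≱ i<Y (subst (Y k ≤_) (trans (sym s*Y+i≡n) (cong (λ q → q * Y k + i) s≡0)) Y≤n)
    s<Z : s < Z k
    s<Z = ≰⇒> λ Z≤s → <⇒≱ n<Y (begin
      Y k * Z k   ≤⟨ *-monoʳ-≤ (Y k) Z≤s ⟩
      Y k * s     ≡⟨ *-comm (Y k) s ⟩
      s * Y k     ≤⟨ m≤m+n _ i ⟩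
      s * Y k + i ≡⟨ s*Y+i≡n ⟩
      n           ∎)
      where open ≤-Reasoning
    valid : Valid k s (offset (Y k) s i) × inner (Y k) s (offset (Y k) s i) ≡ i
    valid = offset-valid k s i 0<s s<Z i<Y

  codeAt : ℕ → ℕ → ℕ → ℕ
  codeAt k y n = encode k (quot n y) (offset y (quot n y) (rem n y))

  codeAt-primRec : PrimRec 3 codeAt
  codeAt-primRec = primRec
    (call encode encode-primRec (var (# 0) ∷ q ∷ call offset offset-primRec (var (# 1) ∷ q ∷ remᵉ (var (# 2)) (var (# 1)) ∷ []) ∷ []))
    λ k y n → refl
    where
    q : Exp 3
    q = quotᵉ (var (# 2)) (var (# 1))

  opaque
    code : ℕ → ℕ
    code n = if0 n then 0 else codeAt (chunk n) (Yᶜ (chunk n) n) n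

    code-0 : code 0 ≡ 0
    code-0 = refl

    code-pos : ∀ n → 0 < n → code n ≡ codeAt (chunk n) (Yᶜ (chunk n) n) n
    code-pos n 0<n = if0-≢0 (≢-sym (<⇒≢ 0<n))

    code-primRec : PrimRec 1 code
    code-primRec = primRec
      (if0ᵉ var (# 0) then lit 0 else call codeAt codeAt-primRec (k ∷ call Yᶜ Yᶜ-primRec (k ∷ var (# 0) ∷ []) ∷ var (# 0) ∷ []))
      λ n → refl
      where
      k : Exp 1
      k = call chunk chunk-primRec (var (# 0) ∷ [])

  code-position : ∀ k s j → Valid k s j → code (position (Y k) s j) ≡ encode k s j
  code-position k s j valid@(0<s , s<Z , _) = begin
    code n                                       ≡⟨ code-pos n 0<n ⟩
    codeAt (chunk n) (Yᶜ (chunk n) n) n          ≡⟨ cong (λ k′ → codeAt k′ (Yᶜ k′ n) n) (chunk-unique n k Y≤n n<Y) ⟩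
    codeAt k (Yᶜ k n) n                          ≡⟨ cong (λ y → codeAt k y n) (Yᶜ-exact k Y≤n) ⟩
    encode k (quot n (Y k)) (offset (Y k) (quot n (Y k)) (rem n (Y k)))
      ≡⟨ cong₂ (λ q r → encode k q (offset (Y k) q r)) (proj₁ qr) (proj₂ qr) ⟩
    encode k s (offset (Y k) s (inner (Y k) s j)) ≡⟨ cong (encode k s) (offset-inner k s j valid) ⟩
    encode k s j ∎
    where
    open ≡-Reasoning
    n : ℕ
    n = position (Y k) s j
    Y≤n : Y k ≤ n
    Y≤n = ≤-trans (m≤n*m (Y k) s {{>-nonZero 0<s}}) (m≤m+n _ _)
    0<n : 0 < n
    0<n = <-≤-trans (Y>0 k) Y≤n
    n<Y : n < Y (suc k)
    n<Y = s*Y+i<Y[1+k] k s<Z (inner<Y k s j valid)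
    qr : quot n (Y k) ≡ s × rem n (Y k) ≡ inner (Y k) s j
    qr = quot-rem-unique {q = s} (inner<Y k s j valid) refl

  posOf : ℕ → ℕ
  posOf v = if0 v then 0 else decode (λ k → position (Y k)) v

  posOf-0 : posOf 0 ≡ 0
  posOf-0 = refl

  posOf-encode : ∀ k s j → posOf (encode k s j) ≡ position (Y k) s j
  posOf-encode = decode-encode (λ k → position (Y k))

  offsetOK? : ℕ → ℕ → ℕ → ℕ
  offsetOK? k s j = if0 smooth? M s then below-Y? k j else reaches-Y? k j + <-test j (Yᶜ k j + Yᶜ k j)

  offsetOK?-sound : ∀ k s j → offsetOK? k s j ≡ 0 → OffsetOK k s j
  offsetOK?-sound k s j ok = by-smoothness (smooth? M s ≟ 0)
    where
    by-smoothness : Dec (smooth? M s ≡ 0) → OffsetOK k s j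
    by-smoothness (yes smooth) = inj₁ (smooth , below-Y?⇒< k j (trans (sym (if0-≡0 smooth)) ok))
    by-smoothness (no rough)   = inj₂ (rough , Y≤j , j<2Y)
      where
      ok′ : reaches-Y? k j + <-test j (Yᶜ k j + Yᶜ k j) ≡ 0
      ok′ = trans (sym (if0-≢0 rough)) ok
      Y≤j : Y k ≤ j
      Y≤j = reaches-Y?⇒≥ k j (m+n≡0⇒m≡0 _ ok′)
      j<2Y : j < Y k + Y k
      j<2Y = <-test≡0⇒< j _ (subst (λ y → <-test j (y + y) ≡ 0) (Yᶜ-exact k Y≤j) (m+n≡0⇒n≡0 (reaches-Y? k j) ok′))

  offsetOK?-complete : ∀ k s j → OffsetOK k s j → offsetOK? k s j ≡ 0
  offsetOK?-complete k s j (inj₁ (smooth , j<Y))       = trans (if0-≡0 smooth) (<⇒below-Y? k j<Y)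
  offsetOK?-complete k s j (inj₂ (rough , Y≤j , j<2Y)) = trans (if0-≢0 rough) (cong₂ _+_
    (≥⇒reaches-Y? k Y≤j)
    (subst (λ y → <-test j (y + y) ≡ 0) (sym (Yᶜ-exact k Y≤j)) (<⇒<-test≡0 j<2Y)))

  valid? : ℕ → ℕ
  valid? v = if0 v then 0 else ∣ decode encode v - v ∣ + decode validIn? v
    where
    validIn? : ℕ → ℕ → ℕ → ℕ
    validIn? k s j = <-test 0 s + below-Z? k s + offsetOK? k s j

  valid?-encode : ∀ k s j → Valid k s j → valid? (encode k s j) ≡ 0
  valid?-encode k s j (0<s , s<Z , ok) = cong₂ _+_
    (trans (cong (λ u → ∣ u - encode k s j ∣) (decode-encode encode k s j)) (∣n-n∣≡0 (encode k s j)))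
    (trans (decode-encode (λ k s j → <-test 0 s + below-Z? k s + offsetOK? k s j) k s j)
           (cong₂ _+_ (cong₂ _+_ (<⇒<-test≡0 0<s) (<⇒below-Z? k s<Z)) (offsetOK?-complete k s j ok)))

  valid?-sound : ∀ v → valid? v ≡ 0 → v ≡ 0 ⊎ ∃ λ k → ∃₂ λ s j → v ≡ encode k s j × Valid k s j
  valid?-sound zero    _  = inj₁ refl
  valid?-sound (suc w) ok = inj₂ (k , s , j , sym (∣m-n∣≡0⇒m≡n (m+n≡0⇒m≡0 _ ok)) ,
    <-test≡0⇒< 0 s (m+n≡0⇒m≡0 _ (m+n≡0⇒m≡0 _ inner-ok)) ,
    below-Z?⇒< k s (m+n≡0⇒n≡0 (<-test 0 s) (m+n≡0⇒m≡0 _ inner-ok)) ,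
    offsetOK?-sound k s j (m+n≡0⇒n≡0 (<-test 0 s + below-Z? k s) inner-ok))
    where
    k s j : ℕ
    k = chunkOf (suc w)
    s = blockOf (suc w)
    j = offsetOf (suc w)
    inner-ok : <-test 0 s + below-Z? k s + offsetOK? k s j ≡ 0
    inner-ok = m+n≡0⇒n≡0 ∣ encode k s j - suc w ∣ ok

  valid?-0 : valid? 0 ≡ 0
  valid?-0 = refl

  valid?-primRec : PrimRec 1 valid?
  valid?-primRec = primRec
    (if0ᵉ var (# 0) then lit 0 else
       ∣-∣ᵉ (decodeᵉ encode encode-primRec (var (# 0))) (var (# 0)) +ᵉ decodeᵉ _ validIn?-pr (var (# 0)))
    λ v → refl
    where
    validIn?-pr : PrimRec 3 (λ k s j → <-test 0 s + below-Z? k s + offsetOK? k s j)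
    validIn?-pr = primRec
      (sucᵉ (lit 0) ∸ᵉ var (# 1) +ᵉ call below-Z? below-Z?-primRec (var (# 0) ∷ var (# 1) ∷ [])
        +ᵉ (if0ᵉ call (smooth? M) smooth?ₘ-primRec (var (# 1) ∷ []) then call below-Y? below-Y?-primRec (var (# 0) ∷ var (# 2) ∷ [])
            else call reaches-Y? reaches-Y?-primRec (var (# 0) ∷ var (# 2) ∷ [])
                 +ᵉ (sucᵉ (var (# 2)) ∸ᵉ (Yᶜᵉ +ᵉ Yᶜᵉ))))
      λ k s j → refl
      where
      Yᶜᵉ : Exp 3
      Yᶜᵉ = call Yᶜ Yᶜ-primRec (var (# 0) ∷ var (# 2) ∷ [])
  position-induction : (P : ℕ → Set) → P 0 → (∀ k s j → Valid k s j → P (position (Y k) s j)) → ∀ n → P n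
  position-induction P P0 Ppos zero    = P0
  position-induction P P0 Ppos (suc n) =
    let k , s , j , valid , pos≡ = decompose (suc n) (s≤s z≤n) in subst P pos≡ (Ppos k s j valid)

  posOf-code : ∀ n → posOf (code n) ≡ n
  posOf-code = position-induction (λ n → posOf (code n) ≡ n) (trans (cong posOf code-0) posOf-0) λ k s j valid →
    trans (cong posOf (code-position k s j valid)) (posOf-encode k s j)

  valid?-code : ∀ n → valid? (code n) ≡ 0
  valid?-code = position-induction (λ n → valid? (code n) ≡ 0) (trans (cong valid? code-0) valid?-0) λ k s j valid →
    trans (cong valid? (code-position k s j valid)) (valid?-encode k s j valid)

  valid-induction : (P : ℕ → Set) → P 0 → (∀ k s j → Valid k s j → P (encode k s j)) →
    ∀ v → valid? v ≡ 0 → P v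
  valid-induction P P0 Penc v ok =
    [ (λ v≡0 → subst P (sym v≡0) P0) , (λ (k , s , j , v≡ , valid) → subst P (sym v≡) (Penc k s j valid)) ]′
    (valid?-sound v ok)

  code-posOf : ∀ v → valid? v ≡ 0 → code (posOf v) ≡ v
  code-posOf = valid-induction (λ v → code (posOf v) ≡ v) (trans (cong code posOf-0) code-0) λ k s j valid →
    trans (cong code (posOf-encode k s j)) (code-position k s j valid)

-- Ranking a primitive recursive set

module Ranking (V : ℕ → ℕ) (V-primRec : PrimRec 1 V) where

  member : ℕ → ℕ
  member w = if0 V w then 1 else 0

  rank : ℕ → ℕ
  rank = sumBelow member

  rank-primRec : PrimRec 1 rank
  rank-primRec = primRec
    (call (boundedSum member)
      (boundedSum-primRec (primRec (if0ᵉ call V V-primRec (var (# 0) ∷ []) then lit 1 else lit 0) λ w → refl))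
      (var (# 0) ∷ []))
    λ v → refl

  member≤1 : ∀ w → member w ≤ 1
  member≤1 w with V w
  ... | zero  = ≤-refl
  ... | suc _ = z≤n

  rank-mono : rank Preserves _≤_ ⟶ _≤_
  rank-mono {v} v≤v′ with m≤n⇒∃[o]m+o≡n v≤v′
  ... | o , refl = rank-+o v o
    where
    rank-+o : ∀ v o → rank v ≤ rank (v + o)
    rank-+o v zero    rewrite +-identityʳ v = ≤-refl
    rank-+o v (suc o) rewrite +-suc v o     = ≤-trans (rank-+o v o) (m≤m+n _ _)

  rank≤ : ∀ v → rank v ≤ v
  rank≤ zero    = z≤n
  rank≤ (suc v) = ≤-trans (+-mono-≤ (rank≤ v) (member≤1 v)) (≤-reflexive (+-comm v 1))

  rank-suc : ∀ v → V v ≡ 0 → rank (suc v) ≡ suc (rank v)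
  rank-suc v Vv≡0 = trans (cong (rank v +_) (if0-≡0 Vv≡0)) (+-comm (rank v) 1)

  rank-<-member : ∀ {v v′} → V v ≡ 0 → v < v′ → rank v < rank v′
  rank-<-member {v} Vv≡0 v<v′ = ≤-trans (≤-reflexive (sym (rank-suc v Vv≡0))) (rank-mono v<v′)

  rank-injective : ∀ {v v′} → V v ≡ 0 → V v′ ≡ 0 → rank v ≡ rank v′ → v ≡ v′
  rank-injective {v} {v′} Vv Vv′ eq with <-cmp v v′
  ... | tri< v<v′ _ _ = ⊥-elim (<-irrefl eq (rank-<-member Vv v<v′))
  ... | tri≈ _ v≡v′ _ = v≡v′
  ... | tri> _ _ v′<v = ⊥-elim (<-irrefl (sym eq) (rank-<-member Vv′ v′<v))

  rank-surjective : ∀ N y → y < rank N → ∃ λ v → v < N × V v ≡ 0 × rank v ≡ y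
  rank-surjective (suc N) y y<rank with y <? rank N
  ... | yes y<rankN = let v , v<N , Vv , rank≡ = rank-surjective N y y<rankN in v , m<n⇒m<1+n v<N , Vv , rank≡
  ... | no  y≮rankN with V N in eq
  ...   | zero  = N , ≤-refl , eq , ≤-antisym (≮⇒≥ y≮rankN) (≤-pred (subst (y <_) (+-comm (rank N) 1) y<rank))
  ...   | suc _ = ⊥-elim (y≮rankN (subst (y <_) (+-identityʳ (rank N)) y<rank))

  module Unranking (U : ℕ → ℕ) (U-primRec : PrimRec 1 U) (enough : ∀ y → y < rank (suc (U y))) where

    unrank : ℕ → ℕ
    unrank y = μ (λ v → V v + ∣ rank v - y ∣) (suc (U y))

    unrank-primRec : PrimRec 1 unrank
    unrank-primRec = primRec
      (call (boundedMin λ v y → V v + ∣ rank v - y ∣)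
        (boundedMin-primRec (primRec
          (call V V-primRec (var (# 0) ∷ []) +ᵉ ∣-∣ᵉ (call rank rank-primRec (var (# 0) ∷ [])) (var (# 1)))
          λ v y → refl))
        (sucᵉ (call U U-primRec (var (# 0) ∷ [])) ∷ var (# 0) ∷ []))
      λ y → refl

    unrank-correct : ∀ y → V (unrank y) ≡ 0 × rank (unrank y) ≡ y
    unrank-correct y =
      let v , v<N , Vv , rank≡ = rank-surjective (suc (U y)) y (enough y)
          found = μ-found (λ v → V v + ∣ rank v - y ∣) (suc (U y))
                    (trans (cong₂ _+_ Vv (cong (λ r → ∣ r - y ∣) rank≡)) (∣n-n∣≡0 y)) v<N
      in m+n≡0⇒m≡0 _ found , ∣m-n∣≡0⇒m≡n (m+n≡0⇒n≡0 (V (unrank y)) found)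

    unrank-rank : ∀ v → V v ≡ 0 → unrank (rank v) ≡ v
    unrank-rank v Vv = rank-injective (proj₁ (unrank-correct (rank v))) Vv (proj₂ (unrank-correct (rank v)))

module Copy (M : ℕ) where

  open Coding M public
  open Ranking valid? valid?-primRec public

  first-valid : ∀ k → Valid k 1 0
  first-valid k = ≤-refl , ≤-<-trans (Y>0 k) (Y<Z k) , inj₁ (smooth?-1 M , Y>0 k)

  rank-increasing-members : (f : ℕ → ℕ) → (∀ i → f i < f (suc i)) →
    ∀ m → (∀ i → i ≤ m → valid? (f i) ≡ 0) → suc m ≤ rank (suc (f m))
  rank-increasing-members f f< zero    members = subst (1 ≤_) (sym (rank-suc (f zero) (members zero z≤n))) (s≤s z≤n)
  rank-increasing-members f f< (suc m) members = begin
    suc (suc m)             ≤⟨ s≤s (rank-increasing-members f f< m (λ i i≤m → members i (m≤n⇒m≤1+n i≤m))) ⟩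
    suc (rank (suc (f m)))  ≤⟨ s≤s (rank-mono (f< m)) ⟩
    suc (rank (f (suc m)))  ≡⟨ sym (rank-suc (f (suc m)) (members (suc m) ≤-refl)) ⟩
    rank (suc (f (suc m)))  ∎
    where open ≤-Reasoning

  enough-valid-codes : ∀ y → y < rank (suc (encode y 1 0))
  enough-valid-codes y = rank-increasing-members (λ k → encode k 1 0)
    (λ k → s≤s (pair-<-sum {k} {pair 1 0} {suc k} {pair 1 0} (+-monoˡ-< (pair 1 0) (n<1+n k))))
    y (λ k _ → valid?-encode k 1 0 (first-valid k))

  Y≤rank : ∀ k a t → 0 < a → Y k ≤ t → Y k ≤ rank (encode k a t)
  Y≤rank k a t 0<a Y≤t = Y≤rank′ (Y k) ≤-refl
    where
    Y≤rank′ : ∀ y → y ≤ Y k → y ≤ rank (encode k a t)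
    Y≤rank′ zero    _     = z≤n
    Y≤rank′ (suc m) 1+m≤Y = ≤-trans
      (rank-increasing-members (λ j → encode k 1 j) (λ j → s≤s (pair-mono-≤-< {k} {pair 1 j} {k} {pair 1 (suc j)} ≤-refl (pair-mono-≤-< {1} {j} {1} {suc j} ≤-refl (n<1+n j))))
        m (λ j j≤m → valid?-encode k 1 j (≤-refl , ≤-<-trans (Y>0 k) (Y<Z k) , inj₁ (smooth?-1 M , <-≤-trans (s≤s j≤m) 1+m≤Y))))
      (rank-mono (s≤s (pair-mono-≤-< {k} {pair 1 m} {k} {pair a t} ≤-refl (pair-mono-≤-< {1} {m} {a} {t} 0<a (<-≤-trans 1+m≤Y Y≤t)))))

  encode-primRec₁ : PrimRec 1 (λ y → encode y 1 0)
  encode-primRec₁ = primRec (call encode encode-primRec (var (# 0) ∷ lit 1 ∷ lit 0 ∷ [])) λ y → refl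

  open Unranking (λ y → encode y 1 0) encode-primRec₁ enough-valid-codes public


  smooth-below-Y : ∀ k s j → Valid k s j → j < Y k → smooth? M s ≡ 0
  smooth-below-Y k s j (_ , _ , inj₁ (smooth , _))   _   = smooth
  smooth-below-Y k s j (_ , _ , inj₂ (_ , Y≤j , _)) j<Y = ⊥-elim (<⇒≱ j<Y Y≤j)

  -- Y k is only computed once it is known to be at most j + 1; below that the block is smooth and
  -- the successor stays in it.  The same idea drives scaleIn.
  nextIn : ℕ → ℕ → ℕ → ℕ
  nextIn k s j = if0 reaches-Y? k (suc j) then code (suc (position (Yᶜ k (suc j)) s j)) else encode k s (suc j)

  nextIn-correct : ∀ k s j → Valid k s j → nextIn k s j ≡ code (suc (position (Y k) s j))
  nextIn-correct k s j valid@(0<s , s<Z , _) = by-cases (Y k ≤? suc j)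
    where
    by-cases : Dec (Y k ≤ suc j) → nextIn k s j ≡ code (suc (position (Y k) s j))
    by-cases (yes Y≤1+j) = trans (if0-≡0 (≥⇒reaches-Y? k Y≤1+j))
                                 (cong (λ y → code (suc (position y s j))) (Yᶜ-exact k Y≤1+j))
    by-cases (no Y≰1+j)  = begin
      nextIn k s j                 ≡⟨ if0-≢0 (λ eq → Y≰1+j (reaches-Y?⇒≥ k (suc j) eq)) ⟩
      encode k s (suc j)           ≡⟨ sym (code-position k s (suc j) (0<s , s<Z , inj₁ (smooth , 1+j<Y))) ⟩
      code (position (Y k) s (suc j))  ≡⟨ cong code position-suc ⟩
      code (suc (position (Y k) s j))  ∎
      where
      open ≡-Reasoning
      1+j<Y : suc j < Y k
      1+j<Y = ≰⇒> Y≰1+j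
      smooth : smooth? M s ≡ 0
      smooth = smooth-below-Y k s j valid (<-trans (n<1+n j) 1+j<Y)
      position-suc : position (Y k) s (suc j) ≡ suc (position (Y k) s j)
      position-suc = trans (cong (s * Y k +_) (if0-≡0 smooth))
        (trans (+-suc (s * Y k) j) (cong (λ i → suc (s * Y k + i)) (sym (if0-≡0 smooth))))

  next : ℕ → ℕ
  next v = if0 v then code 1 else decode nextIn v

  -- Endpoints of cong are given explicitly wherever inferring them would unfold code.
  next-correct : ∀ v → valid? v ≡ 0 → next v ≡ code (suc (posOf v))
  next-correct = valid-induction (λ v → next v ≡ code (suc (posOf v))) refl λ k s j valid → begin
    next (encode k s j)                ≡⟨ decode-encode nextIn k s j ⟩
    nextIn k s j                       ≡⟨ nextIn-correct k s j valid ⟩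
    code (suc (position (Y k) s j))        ≡⟨ cong (λ p → code (suc p)) {position (Y k) s j} {posOf (encode k s j)} (sym (posOf-encode k s j)) ⟩
    code (suc (posOf (encode k s j)))  ∎
    where open ≡-Reasoning

  scaleIn : ℕ → ℕ → ℕ → ℕ → ℕ
  scaleIn a k s j =
    if0 reaches-Y? k (s * a + j * a) then code (position (Yᶜ k (s * a + j * a)) s j * a) else encode k (s * a) (j * a)

  scaleIn-correct : ∀ a → 0 < a → (∀ s → smooth? M s ≡ 0 → smooth? M (s * a) ≡ 0) →
    ∀ k s j → Valid k s j → scaleIn a k s j ≡ code (position (Y k) s j * a)
  scaleIn-correct a 0<a a-smooth k s j valid@(0<s , s<Z , _) = by-cases (Y k ≤? s * a + j * a)
    where
    by-cases : Dec (Y k ≤ s * a + j * a) → scaleIn a k s j ≡ code (position (Y k) s j * a)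
    by-cases (yes Y≤B) = trans (if0-≡0 (≥⇒reaches-Y? k Y≤B))
                               (cong (λ y → code (position y s j * a)) {Yᶜ k (s * a + j * a)} {Y k} (Yᶜ-exact k Y≤B))
    by-cases (no Y≰B)  = begin
      scaleIn a k s j                       ≡⟨ if0-≢0 (λ eq → Y≰B (reaches-Y?⇒≥ k (s * a + j * a) eq)) ⟩
      encode k (s * a) (j * a)              ≡⟨ sym (code-position k (s * a) (j * a) valid′) ⟩
      code (position (Y k) (s * a) (j * a)) ≡⟨ cong code {position (Y k) (s * a) (j * a)} {position (Y k) s j * a} position-* ⟩
      code (position (Y k) s j * a)         ∎
      where
      open ≡-Reasoning
      B<Y : s * a + j * a < Y k
      B<Y = ≰⇒> Y≰B
      ja<Y : j * a < Y k
      ja<Y = ≤-<-trans (m≤n+m (j * a) (s * a)) B<Y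
      smooth : smooth? M s ≡ 0
      smooth = smooth-below-Y k s j valid (≤-<-trans (m≤m*n j a {{>-nonZero 0<a}}) ja<Y)
      valid′ : Valid k (s * a) (j * a)
      valid′ = *-mono-≤ 0<s 0<a , <-trans (≤-<-trans (m≤m+n (s * a) (j * a)) B<Y) (Y<Z k) ,
               inj₁ (a-smooth s smooth , ja<Y)
      position-* : position (Y k) (s * a) (j * a) ≡ position (Y k) s j * a
      position-* = begin
        s * a * Y k + inner (Y k) (s * a) (j * a) ≡⟨ cong (s * a * Y k +_) (if0-≡0 (a-smooth s smooth)) ⟩
        s * a * Y k + j * a                       ≡⟨ cong (_+ j * a) (trans (*-assoc s a (Y k)) (trans (cong (s *_) (*-comm a (Y k))) (sym (*-assoc s (Y k) a)))) ⟩
        s * Y k * a + j * a                       ≡⟨ sym (*-distribʳ-+ a (s * Y k) j) ⟩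
        (s * Y k + j) * a                         ≡⟨ cong (λ i → (s * Y k + i) * a) (sym (if0-≡0 smooth)) ⟩
        position (Y k) s j * a                    ∎

  scale : ℕ → ℕ → ℕ
  scale a v = if0 v then 0 else decode (scaleIn a) v

  scale-correct : ∀ a → 0 < a → (∀ s → smooth? M s ≡ 0 → smooth? M (s * a) ≡ 0) →
    ∀ v → valid? v ≡ 0 → scale a v ≡ code (posOf v * a)
  scale-correct a 0<a a-smooth = valid-induction (λ v → scale a v ≡ code (posOf v * a)) (sym code-0) λ k s j valid → begin
      scale a (encode k s j)                ≡⟨ decode-encode (scaleIn a) k s j ⟩
      scaleIn a k s j                       ≡⟨ scaleIn-correct a 0<a a-smooth k s j valid ⟩
      code (position (Y k) s j * a)         ≡⟨ cong (λ p → code (p * a)) {position (Y k) s j} {posOf (encode k s j)} (sym (posOf-encode k s j)) ⟩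
      code (posOf (encode k s j) * a)       ∎
    where open ≡-Reasoning

  c : ℕ → ℕ
  c x = rank (code x)

  c⁻¹ : ℕ → ℕ
  c⁻¹ y = posOf (unrank y)

  c⁻¹-c : ∀ x → c⁻¹ (c x) ≡ x
  c⁻¹-c x = trans (cong posOf (unrank-rank (code x) (valid?-code x))) (posOf-code x)

  c-c⁻¹ : ∀ y → c (c⁻¹ y) ≡ y
  c-c⁻¹ y = trans (cong rank (code-posOf (unrank y) (proj₁ (unrank-correct y)))) (proj₂ (unrank-correct y))

  copy : CopyOfS
  copy = record
    { SB     = λ y → c (suc (c⁻¹ y))
    ; c      = c
    ; cinv   = c⁻¹
    ; cinv-c = c⁻¹-c
    ; c-cinv = c-c⁻¹
    ; c-hom  = λ x → cong (λ u → c (suc u)) {x} {c⁻¹ (c x)} (sym (c⁻¹-c x))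
    }

  valid-unrank : ∀ y → valid? (unrank y) ≡ 0
  valid-unrank y = proj₁ (unrank-correct y)

  nextIn-primRec : PrimRec 3 nextIn
  nextIn-primRec = primRec
    (if0ᵉ call reaches-Y? reaches-Y?-primRec (var (# 0) ∷ sucᵉ (var (# 2)) ∷ [])
     then call code code-primRec (sucᵉ (call position position-primRec (Yᶜᵉ ∷ var (# 1) ∷ var (# 2) ∷ [])) ∷ [])
     else call encode encode-primRec (var (# 0) ∷ var (# 1) ∷ sucᵉ (var (# 2)) ∷ []))
    λ k s j → refl
    where
    Yᶜᵉ : Exp 3
    Yᶜᵉ = call Yᶜ Yᶜ-primRec (var (# 0) ∷ sucᵉ (var (# 2)) ∷ [])

  successor-primRec : Punctual copy
  successor-primRec = PrimRec₁-≗
    (∘-primRec rank-primRec (∘-primRec next-primRec unrank-primRec))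
    λ y → cong rank (next-correct (unrank y) (valid-unrank y))
    where
    next-primRec : PrimRec 1 next
    next-primRec = primRec
      (if0ᵉ var (# 0) then call code code-primRec (lit 1 ∷ []) else decodeᵉ nextIn nextIn-primRec (var (# 0)))
      λ v → refl

  scale-primRec : ∀ a → PrimRec 1 (scale a)
  scale-primRec a = primRec
    (if0ᵉ var (# 0) then lit 0 else decodeᵉ (scaleIn a) scaleIn-primRec (var (# 0)))
    λ v → refl
    where
    scaleIn-primRec : PrimRec 3 (scaleIn a)
    scaleIn-primRec = primRec
      (if0ᵉ call reaches-Y? reaches-Y?-primRec (var (# 0) ∷ B ∷ [])
       then call code code-primRec (call position position-primRec (call Yᶜ Yᶜ-primRec (var (# 0) ∷ B ∷ []) ∷ var (# 1) ∷ var (# 2) ∷ []) *ᵉ lit a ∷ [])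
       else call encode encode-primRec (var (# 0) ∷ var (# 1) *ᵉ lit a ∷ var (# 2) *ᵉ lit a ∷ []))
      λ k s j → refl
      where
      B : Exp 3
      B = var (# 1) *ᵉ lit a +ᵉ var (# 2) *ᵉ lit a

  affine-primRec : ∀ a b → 0 < a → (∀ s → smooth? M s ≡ 0 → smooth? M (s * a) ≡ 0) →
    PrimRec 1 (λ y → c (c⁻¹ y * a + b))
  affine-primRec a zero 0<a a-smooth = PrimRec₁-≗
    (∘-primRec rank-primRec (∘-primRec (scale-primRec a) unrank-primRec))
    λ y → trans (cong rank (scale-correct a 0<a a-smooth (unrank y) (valid-unrank y)))
                (cong c {c⁻¹ y * a} {c⁻¹ y * a + 0} (sym (+-identityʳ _)))
  affine-primRec a (suc b) 0<a a-smooth = PrimRec₁-≗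
    (∘-primRec successor-primRec (affine-primRec a b 0<a a-smooth))
    λ y → trans (cong (λ u → c (suc u)) {c⁻¹ (c (c⁻¹ y * a + b))} {c⁻¹ y * a + b} (c⁻¹-c _))
                (cong c {suc (c⁻¹ y * a + b)} {c⁻¹ y * a + suc b} (sym (+-suc _ b)))

  c[Y]≤encode : ∀ k → c (Y k) ≤ encode k 1 0
  c[Y]≤encode k = ≤-trans (rank≤ (code (Y k))) (≤-reflexive (begin
    code (Y k)                   ≡⟨ cong code {Y k} {position (Y k) 1 0} (sym position-1-0) ⟩
    code (position (Y k) 1 0)    ≡⟨ code-position k 1 0 (first-valid k) ⟩
    encode k 1 0                 ∎))
    where
    open ≡-Reasoning
    position-1-0 : position (Y k) 1 0 ≡ Y k
    position-1-0 = trans (cong (1 * Y k +_) (if0-≡0 (smooth?-1 M))) (trans (+-identityʳ _) (*-identityˡ (Y k)))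

  c[a*Y+b]≥Y : ∀ k a b → 0 < a → a < Z k → b < Y k → smooth? M a ≢ 0 → Y k ≤ c (a * Y k + b)
  c[a*Y+b]≥Y k a b 0<a a<Z b<Y rough = subst (Y k ≤_) (cong rank {encode k a (Y k + b)} {code (a * Y k + b)} (sym code≡))
    (Y≤rank k a (Y k + b) 0<a (m≤m+n (Y k) b))
    where
    valid : Valid k a (Y k + b)
    valid = 0<a , a<Z , inj₂ (rough , m≤m+n (Y k) b , +-monoʳ-< (Y k) b<Y)
    position≡ : position (Y k) a (Y k + b) ≡ a * Y k + b
    position≡ = cong (a * Y k +_) (trans (if0-≢0 rough) (m+n∸m≡n (Y k) b))
    code≡ : code (a * Y k + b) ≡ encode k a (Y k + b)
    code≡ = trans (cong code {a * Y k + b} {position (Y k) a (Y k + b)} (sym position≡)) (code-position k a (Y k + b) valid)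

  rough-slope-not-primRec : ∀ a b → 0 < a → smooth? M a ≢ 0 → ¬ PrimRec 1 (λ y → c (a * c⁻¹ y + b))
  rough-slope-not-primRec a b 0<a rough (t , t≗) = <-irrefl refl (begin-strict
    Y k                        ≤⟨ c[a*Y+b]≥Y k a b 0<a a<Z b<Y rough ⟩
    c (a * Y k + b)            ≡⟨ cong (λ x → c (a * x + b)) {Y k} {c⁻¹ y} (sym (c⁻¹-c (Y k))) ⟩
    c (a * c⁻¹ y + b)          ≡⟨ sym (t≗ y) ⟩
    eval t (y ∷ [])            <⟨ proj₂ (eval-majorised t) (y ∷ []) ⟩
    fast m (y ⊔ 0)             ≡⟨ cong (fast m) (⊔-identityʳ y) ⟩
    fast m y                   ≤⟨ fast-monoˡ y m≤k ⟩
    fast k y                   ≤⟨ fast-mono k (c[Y]≤encode k) ⟩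
    fast k (encode k 1 0)      ≤⟨ fast-mono k (m≤n+m _ (Y k′)) ⟩
    Z k′                       ≤⟨ m≤n*m (Z k′) (Y k′) {{>-nonZero (Y>0 k′)}} ⟩
    Y k                        ∎)
    where
    open ≤-Reasoning
    m k′ k y : ℕ
    m = proj₁ (eval-majorised t)
    k′ = m + a + b
    k = suc k′
    y = c (Y k)
    m≤k : m ≤ k
    m≤k = ≤-trans (m≤m+n m a) (≤-trans (m≤m+n (m + a) b) (n≤1+n k′))
    a<Z : a < Z k
    a<Z = <-trans (≤-<-trans (≤-trans (m≤n+m a m) (m≤m+n (m + a) b)) (<-trans (n<1+n k′) (n<Y[n] k))) (Y<Z k)
    b<Y : b < Y k
    b<Y = ≤-<-trans (m≤n+m b (m + a)) (<-trans (n<1+n k′) (n<Y[n] k))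

mainTheorem6 : (P : List ℕ) → All Prime P →
    Σ CopyOfS λ B → Punctual B ×
      ((a b : ℕ) → a ≥ 1 →
        (PrimRecOn B (linear a b) ⇔ ((q : ℕ) → Prime q → q ∣ a → q ∈ P)))
mainTheorem6 P primes = copy , successor-primRec , λ a b 0<a → mk⇔ (only-if a b 0<a) (if a b 0<a)
  where
  open Copy (product P)
  only-if : ∀ a b → 0 < a → PrimRec 1 (λ y → c (a * c⁻¹ y + b)) → ∀ q → Prime q → q ∣ a → q ∈ P
  only-if a b 0<a pr q pq q∣a = by-smoothness (smooth? (product P) a ≟ 0)
    where
    by-smoothness : Dec (smooth? (product P) a ≡ 0) → q ∈ P
    by-smoothness (yes smooth) = smooth?-prime-factor primes pq q∣a smooth
    by-smoothness (no rough)   = ⊥-elim (rough-slope-not-primRec a b 0<a rough pr)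
  if : ∀ a b → 0 < a → (∀ q → Prime q → q ∣ a → q ∈ P) → PrimRec 1 (λ y → c (a * c⁻¹ y + b))
  if a b 0<a factors∈P = PrimRec₁-≗
    (affine-primRec a b 0<a λ s smooth →
      subst (λ n → smooth? (product P) n ≡ 0) (*-comm a s) (smooth?-*-closed primes a 0<a factors∈P s smooth))
    λ y → cong (λ x → c (x + b)) {c⁻¹ y * a} {a * c⁻¹ y} (*-comm (c⁻¹ y) a)
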